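{- Let $n\ge1$, $\pi\in\mathfrak S_n(231)$ and $\sigma\in\mathfrak S_n(321)$. Then $\Phi(\pi)=\sigma$ if and only if for all $i,a\in\{1,\dots,n\}$: $$(n+1-i,a)\in\mathrm{RMIN}(\pi)\iff(n+1-a,i)\in\mathrm{RMIN}(\sigma).$$
   Context: Permutations are words $a_1\dots a_n$ with $a_i=\pi(i)$; $\mathfrak S_n(\tau)$ is the set of $\tau$-avoiding permutations of length $n$ ($\pi$ avoids $231$ if there are no $i<j<k$ with $a_k<a_i<a_j$; avoids $321$ if there are no $i<j<k$ with $a_i>a_j>a_k$). A letter $a_i$ is a right-to-left minimum if $a_i<a_j$ for all $j>i$; $\mathrm{RMIN}(\pi)=\{(i,a_i): a_i\text{ is a right-to-left minimum}\}$. Left-to-right maxima are defined analogously ($a_i>a_j$ for all $j<i$). For permutations $\sigma$ of length $k$ and $\tau$, $\sigma\oplus\tau$ is $\sigma$ followed by $\tau$ with $k$ added to each letter of $\tau$; a nonempty permutation is indecomposable if it is not $\sigma\oplus\tau$ with both nonempty; every permutation is uniquely $\pi_1\oplus\dots\oplus\pi_k$ with indecomposable $\pi_j$ (empty permutation $\epsilon$ for $k=0$). For $\tau\in\mathfrak S_{m-1}(231)$ let $\alpha(\tau)$ be the word $m\,\tau$ (prepend $m$); the indecomposable $231$-avoiding permutations of length $m$ are exactly the $\alpha(\tau)$. For $\tau=b_1\dots b_{m-1}\in\mathfrak S_{m-1}(321)$ define $\beta(\tau)\in\mathfrak S_m(321)$: if $m=1$, $\beta(\epsilon)=1$; otherwise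 mark ("box") the letters of $\tau$ that lie to the right of the letter $1$ and are left-to-right maxima but not right-to-left minima of $\tau$; insert a new letter $m$ immediately to the left of the letter $1$ and box it; if the boxed letters, read left to right in this new word, are $c_1,c_2,\dots,c_r$ (occupying positions $p_1<\dots<p_r$), replace them by $c_2,c_3,\dots,c_r,c_1$ in these positions (cyclic shift one step to the left). Example: $\tau=241357698$ gives $2\,4\,10\,1\,3\,5\,7\,6\,9\,8$ with boxed $10,7,9$, and $\beta(\tau)=2\,4\,7\,1\,3\,5\,9\,6\,10\,8$. The map $\Phi$ from $231$-avoiding to $321$-avoiding permutations is defined recursively by $\Phi(\epsilon)=\epsilon$, $\Phi(\alpha(\tau))=\beta(\Phi(\tau))$, and $\Phi(\pi_1\oplus\pi_2\oplus\dots\oplus\pi_k)=\Phi(\pi_k)\oplus\dots\oplus\Phi(\pi_1)$ for indecomposable $\pi_j$. -}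

module Defs where

open import Data.Nat using (ℕ; zero; suc; _+_; _∸_; _≤_; _<_; _⊔_; _≡ᵇ_; _<ᵇ_)
open import Data.Bool using (Bool; true; false; _∧_; not; if_then_else_)
open import Data.List using (List; []; _∷_; _++_; map; length; upTo; reverse; foldl; take; drop)
open import Data.Product using (_×_; _,_; proj₁; proj₂)
open import Data.Empty using (⊥)
open import Relation.Nullary using (¬_)
open import Relation.Binary.PropositionalEquality using (_≡_)
open import Data.List.Relation.Binary.Permutation.Propositional using (_↭_)

oneToN : ℕ → List ℕ
oneToN n = map suc (upTo n)

IsPerm : ℕ → List ℕ → Set
IsPerm n w = w ↭ oneToN n

-- the letter at (1-based) position i; 0 if out of range
at : List ℕ → ℕ → ℕ
at []       _             = 0
at (x ∷ xs) zero          = 0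
at (x ∷ xs) (suc zero)    = x
at (x ∷ xs) (suc (suc i)) = at xs (suc i)

Avoids231 : List ℕ → Set
Avoids231 w = ∀ i j k → 1 ≤ i → i < j → j < k → k ≤ length w →
  ¬ (at w k < at w i × at w i < at w j)

Avoids321 : List ℕ → Set
Avoids321 w = ∀ i j k → 1 ≤ i → i < j → j < k → k ≤ length w →
  ¬ (at w i > at w j × at w j > at w k)
  where
  _>_ : ℕ → ℕ → Set
  a > b = b < a

RMIN : List ℕ → ℕ → ℕ → Set
RMIN w i a = (1 ≤ i) × (i ≤ length w) × (at w i ≡ a) ×
  (∀ j → i < j → j ≤ length w → a < at w j)

_⊕_ : List ℕ → List ℕ → List ℕ
σ ⊕ τ = σ ++ map (λ x → x + length σ) τ

-- split off the first ⊕-component: shortest nonempty prefix whose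
-- letters are exactly 1..k (i.e. its maximum equals its length)
splitGo : ℕ → ℕ → List ℕ → List ℕ → List ℕ × List ℕ
splitGo m c acc []       = reverse acc , []
splitGo m c acc (x ∷ xs) =
  if (m ⊔ x) ≡ᵇ suc c then (reverse (x ∷ acc) , xs)
  else splitGo (m ⊔ x) (suc c) (x ∷ acc) xs

splitFirst : List ℕ → List ℕ × List ℕ
splitFirst w = splitGo 0 0 [] w

-- decomposition π = π₁ ⊕ … ⊕ πₖ into (standardised) indecomposables;
-- the first argument is fuel (length of the word suffices)
components : ℕ → List ℕ → List (List ℕ)
components zero    _  = []
components (suc f) [] = []
components (suc f) w@(_ ∷ _) with splitFirst w
... | p , r = p ∷ components f (map (λ x → x ∸ length p) r)

allB : {A : Set} → (A → Bool) → List A → Bool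
allB p [] = true
allB p (x ∷ xs) = p x ∧ allB p xs

anyB : {A : Set} → (A → Bool) → List A → Bool
anyB p [] = false
anyB p (x ∷ xs) = if p x then true else anyB p xs

isOne : ℕ → Bool
isOne x = x ≡ᵇ 1

-- annotate τ: insert m (boxed) immediately left of the letter 1 and box
-- the letters right of 1 that are LR maxima but not RL minima of τ
annot : ℕ → List ℕ → List ℕ → List (ℕ × Bool)
annot m pre []       = []
annot m pre (x ∷ xs) =
  let seen1  = anyB isOne pre
      lrmax  = allB (λ y → y <ᵇ x) pre
      rlmin  = allB (λ y → x <ᵇ y) xs
      rest   = annot m (x ∷ pre) xs
      here   = (x , seen1 ∧ lrmax ∧ not rlmin) ∷ rest
  in if isOne x then (m , true) ∷ here else here

boxedVals : List (ℕ × Bool) → List ℕ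
boxedVals []               = []
boxedVals ((x , true) ∷ r)  = x ∷ boxedVals r
boxedVals ((x , false) ∷ r) = boxedVals r

refill : List (ℕ × Bool) → List ℕ → List ℕ
refill []               _        = []
refill ((x , false) ∷ r) cs      = x ∷ refill r cs
refill ((x , true) ∷ r)  []      = x ∷ refill r []
refill ((x , true) ∷ r)  (c ∷ cs) = c ∷ refill r cs

β : List ℕ → List ℕ
β [] = 1 ∷ []
β τ@(_ ∷ _) =
  let ws = annot (suc (length τ)) [] τ
      bs = boxedVals ws
  in refill ws (drop 1 bs ++ take 1 bs)

mutual
  phi : ℕ → List ℕ → List ℕ
  phi zero    _ = []
  phi (suc f) w = foldl (λ acc c → phiInd f c ⊕ acc) [] (components (suc f) w)

  -- Φ(α(τ)) = β(Φ(τ)), where α(τ) = m τ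
  phiInd : ℕ → List ℕ → List ℕ
  phiInd f []      = []
  phiInd f (m ∷ τ) = β (phi f τ)

Φ : List ℕ → List ℕ
Φ w = phi (length w) w

-- Record the right-to-left minima of a word as its profile: the k-th entry
-- is a_k when a_k is a right-to-left minimum and nothing otherwise. Read
-- from the right, the condition of the theorem says that the profiles of π
-- and σ are mutually transposed partial permutation matrices. Φ π has this
-- property by induction along the recursion: reversing the order of the
-- ⊕-summands exchanges the two blocks of both reversed profiles, while α and
-- β each put a new leading letter that is not a right-to-left minimum, and
-- β moves only letters that are not right-to-left minima. The induction also
-- keeps the non-minima of Φ π increasing, which is what makes the boxed
-- letters after the 1 exactly the non-minima. Conversely, the non-minima of
-- a 321-avoiding permutation increase, so it is determined by its profile,
-- and the condition determines that profile from π.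

module Submission where

open import Defs
open import Data.Nat using (ℕ; zero; suc; _+_; _∸_; _≤_; _<_; _≡ᵇ_; _<ᵇ_; z≤n; s≤s; _<?_)
import Data.Nat.Properties as ℕ
open import Data.Bool using (Bool; true; false; T; _∧_; not; if_then_else_)
open import Data.Bool.Properties using (T-≡; ⇔→≡; ∧-conicalˡ; ∧-conicalʳ; ∧-identityʳ; not-involutive)
open import Data.List using (List; []; _∷_; _++_; map; length; upTo; reverse; foldl; take; drop; [_]; filter; catMaybes)
import Data.List.Properties as List
open import Data.Maybe using (Maybe; just; nothing)
import Data.Maybe as Maybe
open import Data.Maybe.Properties using (just-injective)
open import Data.Product using (∃-syntax; _×_; _,_; proj₁; proj₂)
open import Data.Sum using (_⊎_; inj₁; inj₂)
open import Data.Empty using (⊥; ⊥-elim)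
open import Data.Unit using (⊤; tt)
open import Function using (_∘_; case_of_)
open import Function.Bundles using (_⇔_; mk⇔; Equivalence)
open import Relation.Nullary using (¬_; yes; no)
open import Relation.Binary.PropositionalEquality hiding ([_])
open import Data.List.Relation.Unary.All as All using (All; []; _∷_)
import Data.List.Relation.Unary.All.Properties as All
open import Data.List.Relation.Unary.Any as Any using (Any; here; there)
import Data.List.Relation.Unary.Any.Properties as Any
open import Data.List.Relation.Unary.AllPairs as AllPairs using (AllPairs; []; _∷_)
import Data.List.Relation.Unary.AllPairs.Properties as AllPairs
open import Data.List.Relation.Unary.Unique.Propositional using (Unique)
open import Data.List.Membership.Propositional using (_∈_; find)
open import Data.List.Membership.Propositional.Properties
  using (∈-++⁺ˡ; ∈-++⁺ʳ; ∈-++⁻; ∈-map⁻; ∈-∃++)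
open import Data.List.Relation.Binary.Permutation.Propositional
  using (_↭_; ↭-sym; ↭-trans; ↭-refl; prep; swap; ↭⇒↭ₛ; module PermutationReasoning)
import Data.List.Relation.Binary.Permutation.Propositional.Properties as ↭
import Data.List.Relation.Binary.Permutation.Setoid.Properties

private
  variable
    A : Set

≡true⇒T : ∀ {b} → b ≡ true → T b
≡true⇒T = Equivalence.from T-≡

<ᵇ≡true⇒< : ∀ {x y} → (x <ᵇ y) ≡ true → x < y
<ᵇ≡true⇒< {x} {y} e = ℕ.<ᵇ⇒< x y (≡true⇒T e)

<⇒<ᵇ≡true : ∀ {x y} → x < y → (x <ᵇ y) ≡ true
<⇒<ᵇ≡true x<y = Equivalence.to T-≡ (ℕ.<⇒<ᵇ x<y)

<ᵇ≡false⇒≥ : ∀ {x y} → (x <ᵇ y) ≡ false → y ≤ x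
<ᵇ≡false⇒≥ e = ℕ.≮⇒≥ (λ x<y → subst T e (ℕ.<⇒<ᵇ x<y))

≥⇒<ᵇ≡false : ∀ {x y} → y ≤ x → (x <ᵇ y) ≡ false
≥⇒<ᵇ≡false {x} {y} y≤x with x <ᵇ y in eq
... | false = refl
... | true  = ⊥-elim (ℕ.<⇒≱ (<ᵇ≡true⇒< eq) y≤x)

+-cancelʳ-<ᵇ : ∀ x y k → (x + k <ᵇ y + k) ≡ (x <ᵇ y)
+-cancelʳ-<ᵇ x y k = ⇔→≡ {z = true} (mk⇔
  (λ e → <⇒<ᵇ≡true (ℕ.+-cancelʳ-< k x y (<ᵇ≡true⇒< {x + k} {y + k} e)))
  (λ e → <⇒<ᵇ≡true (ℕ.+-monoˡ-< k (<ᵇ≡true⇒< {x} {y} e))))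

≡⇒≡ᵇ≡true : ∀ {x y} → x ≡ y → (x ≡ᵇ y) ≡ true
≡⇒≡ᵇ≡true {x} {y} x≡y = Equivalence.to T-≡ (ℕ.≡⇒≡ᵇ x y x≡y)

≢⇒≡ᵇ≡false : ∀ {x y} → ¬ x ≡ y → (x ≡ᵇ y) ≡ false
≢⇒≡ᵇ≡false {x} {y} x≢y with x ≡ᵇ y in eq
... | false = refl
... | true  = ⊥-elim (x≢y (ℕ.≡ᵇ⇒≡ x y (≡true⇒T eq)))

allB≡true⇒All : (p : A → Bool) (xs : List A) → allB p xs ≡ true → All (λ x → p x ≡ true) xs
allB≡true⇒All p []       _ = []
allB≡true⇒All p (x ∷ xs) e = ∧-conicalˡ (p x) _ e ∷ allB≡true⇒All p xs (∧-conicalʳ (p x) _ e)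

All⇒allB≡true : (p : A → Bool) (xs : List A) → All (λ x → p x ≡ true) xs → allB p xs ≡ true
All⇒allB≡true p []       []         = refl
All⇒allB≡true p (x ∷ xs) (px ∷ pxs) rewrite px = All⇒allB≡true p xs pxs

allB≡false⇒Any : (p : A → Bool) (xs : List A) → allB p xs ≡ false → Any (λ x → p x ≡ false) xs
allB≡false⇒Any p (x ∷ xs) e with p x in eq
... | false = here eq
... | true  = there (allB≡false⇒Any p xs e)

Any⇒allB≡false : (p : A → Bool) (xs : List A) → Any (λ x → p x ≡ false) xs → allB p xs ≡ false
Any⇒allB≡false p (x ∷ xs) (here px) rewrite px = refl
Any⇒allB≡false p (x ∷ xs) (there any) with p x
... | true  = Any⇒allB≡false p xs any
... | false = refl

allB-++ : (p : A → Bool) (xs ys : List A) → allB p (xs ++ ys) ≡ (allB p xs ∧ allB p ys)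
allB-++ p []       ys = refl
allB-++ p (x ∷ xs) ys with p x
... | true  = allB-++ p xs ys
... | false = refl

belowAll : ℕ → List ℕ → Bool
belowAll x = allB (x <ᵇ_)

belowAll≡true⇒All : ∀ x xs → belowAll x xs ≡ true → All (x <_) xs
belowAll≡true⇒All x xs e = All.map <ᵇ≡true⇒< (allB≡true⇒All (x <ᵇ_) xs e)

All⇒belowAll≡true : ∀ x xs → All (x <_) xs → belowAll x xs ≡ true
All⇒belowAll≡true x xs x<xs = All⇒allB≡true (x <ᵇ_) xs (All.map <⇒<ᵇ≡true x<xs)

belowAll≡false⇒∃≤ : ∀ x xs → belowAll x xs ≡ false → ∃[ y ] y ∈ xs × y ≤ x
belowAll≡false⇒∃≤ x xs e with find (allB≡false⇒Any (x <ᵇ_) xs e)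
... | y , y∈xs , x≮ᵇy = y , y∈xs , <ᵇ≡false⇒≥ x≮ᵇy

∃≤⇒belowAll≡false : ∀ x xs {y} → y ∈ xs → y ≤ x → belowAll x xs ≡ false
∃≤⇒belowAll≡false x xs y∈xs y≤x =
  Any⇒allB≡false (x <ᵇ_) xs (Any.map (λ { refl → ≥⇒<ᵇ≡false y≤x }) y∈xs)

Increasing : List ℕ → Set
Increasing = AllPairs _<_

increasing-++⁻ˡ : ∀ xs {ys} → Increasing (xs ++ ys) → Increasing xs
increasing-++⁻ˡ []       _          = []
increasing-++⁻ˡ (x ∷ xs) (x< ∷ inc) = All.++⁻ˡ xs x< ∷ increasing-++⁻ˡ xs inc

oneToN-suc : ∀ n → oneToN (suc n) ≡ oneToN n ++ [ suc n ]
oneToN-suc n = trans (cong (map suc) (sym (List.upTo-∷ʳ n))) (List.map-++ suc (upTo n) [ n ])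

∈-oneToN⁻ : ∀ {n x} → x ∈ oneToN n → 1 ≤ x × x ≤ n
∈-oneToN⁻ {zero}  ()
∈-oneToN⁻ {suc n} x∈ rewrite oneToN-suc n with ∈-++⁻ (oneToN n) x∈
... | inj₁ x∈′         = proj₁ (∈-oneToN⁻ x∈′) , ℕ.m≤n⇒m≤1+n (proj₂ (∈-oneToN⁻ x∈′))
... | inj₂ (here refl) = s≤s z≤n , ℕ.≤-refl

∈-oneToN⁺ : ∀ {n x} → 1 ≤ x → x ≤ n → x ∈ oneToN n
∈-oneToN⁺ {zero}  () z≤n
∈-oneToN⁺ {suc n} 1≤x x≤n rewrite oneToN-suc n with ℕ.m≤n⇒m<n∨m≡n x≤n
... | inj₁ x<n  = ∈-++⁺ˡ (∈-oneToN⁺ 1≤x (ℕ.≤-pred x<n))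
... | inj₂ refl = ∈-++⁺ʳ (oneToN n) (here refl)

oneToN-increasing : ∀ n → Increasing (oneToN n)
oneToN-increasing zero    = []
oneToN-increasing (suc n) rewrite oneToN-suc n =
  AllPairs.++⁺ (oneToN-increasing n) ([] ∷ [])
    (All.tabulate (λ x∈ → s≤s (proj₂ (∈-oneToN⁻ x∈)) ∷ []))

oneToN-+ : ∀ a b → oneToN (a + b) ≡ oneToN a ++ map (_+ a) (oneToN b)
oneToN-+ a zero    = trans (cong oneToN (ℕ.+-identityʳ a)) (sym (List.++-identityʳ _))
oneToN-+ a (suc b) = begin
  oneToN (a + suc b)                                    ≡⟨ cong oneToN (ℕ.+-suc a b) ⟩
  oneToN (suc (a + b))                                  ≡⟨ oneToN-suc (a + b) ⟩
  oneToN (a + b) ++ [ suc (a + b) ]                     ≡⟨ cong₂ (λ xs z → xs ++ [ suc z ]) (oneToN-+ a b) (ℕ.+-comm a b) ⟩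
  (oneToN a ++ map (_+ a) (oneToN b)) ++ [ suc b + a ]  ≡⟨ List.++-assoc (oneToN a) _ _ ⟩
  oneToN a ++ map (_+ a) (oneToN b) ++ [ suc b + a ]    ≡⟨ cong (oneToN a ++_) (sym (List.map-++ (_+ a) (oneToN b) [ suc b ])) ⟩
  oneToN a ++ map (_+ a) (oneToN b ++ [ suc b ])        ≡⟨ cong (λ z → oneToN a ++ map (_+ a) z) (sym (oneToN-suc b)) ⟩
  oneToN a ++ map (_+ a) (oneToN (suc b))               ∎
  where open ≡-Reasoning

module _ {n : ℕ} {w : List ℕ} (w-perm : IsPerm n w) where

  isPerm-length : length w ≡ n
  isPerm-length = trans (↭.↭-length w-perm) (trans (List.length-map suc (upTo n)) (List.length-upTo n))

  isPerm-bounds : All (λ x → 1 ≤ x × x ≤ n) w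
  isPerm-bounds = All.tabulate (λ x∈w → ∈-oneToN⁻ (↭.∈-resp-↭ w-perm x∈w))

  isPerm-positive : All (1 ≤_) w
  isPerm-positive = All.map proj₁ isPerm-bounds

  isPerm-≤length : All (_≤ length w) w
  isPerm-≤length = All.map (λ b → subst (_ ≤_) (sym isPerm-length) (proj₂ b)) isPerm-bounds

  isPerm-∈ : ∀ {x} → 1 ≤ x → x ≤ n → x ∈ w
  isPerm-∈ 1≤x x≤n = ↭.∈-resp-↭ (↭-sym w-perm) (∈-oneToN⁺ 1≤x x≤n)

  isPerm-unique : Unique w
  isPerm-unique = ↭ₛ.Unique-resp-↭ (↭⇒↭ₛ (↭-sym w-perm))
    (AllPairs.map ℕ.<⇒≢ (oneToN-increasing n))
    where module ↭ₛ = Data.List.Relation.Binary.Permutation.Setoid.Properties (setoid ℕ)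

unique-middle : ∀ (L : List ℕ) {y R} → Unique (L ++ y ∷ R) → All (λ x → ¬ x ≡ y) L × All (λ x → ¬ y ≡ x) R
unique-middle []      (y∉R ∷ _) = [] , y∉R
unique-middle (l ∷ L) (l∉ ∷ u)  = All.head (All.++⁻ʳ L l∉) ∷ proj₁ (unique-middle L u) , proj₂ (unique-middle L u)

isPerm-⊕ : ∀ {k l a b} → IsPerm k a → IsPerm l b → IsPerm (k + l) (a ⊕ b)
isPerm-⊕ {k} {l} a-perm b-perm rewrite oneToN-+ k l | isPerm-length a-perm =
  ↭.++⁺ a-perm (↭.map⁺ (_+ k) b-perm)

isPerm-∷ : ∀ {n w} → IsPerm n w → IsPerm (suc n) (suc n ∷ w)
isPerm-∷ {n} {w} w-perm rewrite oneToN-suc n =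
  ↭-trans (↭.∷↭∷ʳ (suc n) w) (↭.++⁺ʳ [ suc n ] w-perm)

⊕-identityˡ : ∀ b → [] ⊕ b ≡ b
⊕-identityˡ b = List.map-id-local (All.tabulate {xs = b} (λ {x} _ → ℕ.+-identityʳ x))

⊕-identityʳ : ∀ a → a ⊕ [] ≡ a
⊕-identityʳ = List.++-identityʳ

⊕-assoc : ∀ a b c → (a ⊕ b) ⊕ c ≡ a ⊕ (b ⊕ c)
⊕-assoc a b c = begin
  (a ++ map (_+ length a) b) ++ map (_+ length (a ⊕ b)) c         ≡⟨ List.++-assoc a _ _ ⟩
  a ++ map (_+ length a) b ++ map (_+ length (a ⊕ b)) c           ≡⟨ cong (λ z → a ++ map (_+ length a) b ++ z) shift ⟩
  a ++ map (_+ length a) b ++ map (_+ length a) (map (_+ length b) c) ≡⟨ cong (a ++_) (sym (List.map-++ (_+ length a) b _)) ⟩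
  a ⊕ (b ⊕ c)                                                       ∎
  where
  open ≡-Reasoning
  length-⊕ : length (a ⊕ b) ≡ length b + length a
  length-⊕ = trans (List.length-++ a) (trans (cong (length a +_) (List.length-map _ b)) (ℕ.+-comm (length a) _))
  shift : map (_+ length (a ⊕ b)) c ≡ map (_+ length a) (map (_+ length b) c)
  shift = trans (List.map-cong (λ y → trans (cong (y +_) length-⊕) (sym (ℕ.+-assoc y _ _))) c) (List.map-∘ c)

foldl-⊕ : (f : List ℕ → List ℕ) (cs : List (List ℕ)) (acc : List ℕ) →
  foldl (λ acc c → f c ⊕ acc) acc cs ≡ foldl (λ acc c → f c ⊕ acc) [] cs ⊕ acc
foldl-⊕ f []       acc = sym (⊕-identityˡ acc)
foldl-⊕ f (c ∷ cs) acc = begin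
  fold (f c ⊕ acc) cs          ≡⟨ foldl-⊕ f cs (f c ⊕ acc) ⟩
  fold [] cs ⊕ (f c ⊕ acc)     ≡⟨ sym (⊕-assoc (fold [] cs) (f c) acc) ⟩
  (fold [] cs ⊕ f c) ⊕ acc     ≡⟨ cong (λ z → (fold [] cs ⊕ z) ⊕ acc) (sym (⊕-identityʳ (f c))) ⟩
  (fold [] cs ⊕ (f c ⊕ [])) ⊕ acc ≡⟨ cong (_⊕ acc) (sym (foldl-⊕ f cs (f c ⊕ []))) ⟩
  fold [] (c ∷ cs) ⊕ acc       ∎
  where
  open ≡-Reasoning
  fold : List ℕ → List (List ℕ) → List ℕ
  fold = foldl (λ acc c → f c ⊕ acc)

-- The right-to-left-minimum profile of a word

rminFlags : List ℕ → List Bool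
rminFlags []       = []
rminFlags (x ∷ xs) = belowAll x xs ∷ rminFlags xs

marked : List ℕ → List Bool → List (Maybe ℕ)
marked []       _            = []
marked (x ∷ xs) []           = []
marked (x ∷ xs) (true  ∷ bs) = just x ∷ marked xs bs
marked (x ∷ xs) (false ∷ bs) = nothing ∷ marked xs bs

unmarked : List ℕ → List Bool → List ℕ
unmarked []       _            = []
unmarked (x ∷ xs) []           = []
unmarked (x ∷ xs) (true  ∷ bs) = unmarked xs bs
unmarked (x ∷ xs) (false ∷ bs) = x ∷ unmarked xs bs

profile : List ℕ → List (Maybe ℕ)
profile w = marked w (rminFlags w)

nonRmins : List ℕ → List ℕ
nonRmins w = unmarked w (rminFlags w)

-- Read from the right, as in the theorem: entry i-1 concerns position n+1-i.
rprofile : List ℕ → List (Maybe ℕ)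
rprofile w = reverse (profile w)

length-rminFlags : ∀ w → length (rminFlags w) ≡ length w
length-rminFlags []      = refl
length-rminFlags (x ∷ w) = cong suc (length-rminFlags w)

length-marked : ∀ w bs → length bs ≡ length w → length (marked w bs) ≡ length w
length-marked []      bs           _ = refl
length-marked (x ∷ w) (true  ∷ bs) e = cong suc (length-marked w bs (ℕ.suc-injective e))
length-marked (x ∷ w) (false ∷ bs) e = cong suc (length-marked w bs (ℕ.suc-injective e))

length-profile : ∀ w → length (profile w) ≡ length w
length-profile w = length-marked w (rminFlags w) (length-rminFlags w)

length-rprofile : ∀ w → length (rprofile w) ≡ length w
length-rprofile w = trans (List.length-reverse (profile w)) (length-profile w)

module _ (p : ℕ) (rest : List ℕ) where

  profile-∷-rmin : belowAll p rest ≡ true → profile (p ∷ rest) ≡ just p ∷ profile rest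
  profile-∷-rmin e = cong (λ b → marked (p ∷ rest) (b ∷ rminFlags rest)) e

  profile-∷-nonrmin : belowAll p rest ≡ false → profile (p ∷ rest) ≡ nothing ∷ profile rest
  profile-∷-nonrmin e = cong (λ b → marked (p ∷ rest) (b ∷ rminFlags rest)) e

  nonRmins-∷-rmin : belowAll p rest ≡ true → nonRmins (p ∷ rest) ≡ nonRmins rest
  nonRmins-∷-rmin e = cong (λ b → unmarked (p ∷ rest) (b ∷ rminFlags rest)) e

  nonRmins-∷-nonrmin : belowAll p rest ≡ false → nonRmins (p ∷ rest) ≡ p ∷ nonRmins rest
  nonRmins-∷-nonrmin e = cong (λ b → unmarked (p ∷ rest) (b ∷ rminFlags rest)) e

  rprofile-∷-nonrmin : belowAll p rest ≡ false → rprofile (p ∷ rest) ≡ rprofile rest ++ [ nothing ]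
  rprofile-∷-nonrmin e = trans (cong reverse (profile-∷-nonrmin e)) (List.unfold-reverse nothing (profile rest))

rminFlags-++ : ∀ as bs → All (λ x → belowAll x bs ≡ true) as →
  rminFlags (as ++ bs) ≡ rminFlags as ++ rminFlags bs
rminFlags-++ []       bs []         = refl
rminFlags-++ (x ∷ as) bs (x<bs ∷ h) = cong₂ _∷_
  (trans (allB-++ (x <ᵇ_) as bs) (trans (cong (belowAll x as ∧_) x<bs) (∧-identityʳ _)))
  (rminFlags-++ as bs h)

marked-++ : ∀ as fs bs gs → length fs ≡ length as → marked (as ++ bs) (fs ++ gs) ≡ marked as fs ++ marked bs gs
marked-++ []       []           bs gs e = refl
marked-++ (x ∷ as) (true  ∷ fs) bs gs e = cong (just x ∷_) (marked-++ as fs bs gs (ℕ.suc-injective e))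
marked-++ (x ∷ as) (false ∷ fs) bs gs e = cong (nothing ∷_) (marked-++ as fs bs gs (ℕ.suc-injective e))

unmarked-++ : ∀ as fs bs gs → length fs ≡ length as → unmarked (as ++ bs) (fs ++ gs) ≡ unmarked as fs ++ unmarked bs gs
unmarked-++ []       []           bs gs e = refl
unmarked-++ (x ∷ as) (true  ∷ fs) bs gs e = unmarked-++ as fs bs gs (ℕ.suc-injective e)
unmarked-++ (x ∷ as) (false ∷ fs) bs gs e = cong (x ∷_) (unmarked-++ as fs bs gs (ℕ.suc-injective e))

rminFlags-map-+ : ∀ k w → rminFlags (map (_+ k) w) ≡ rminFlags w
rminFlags-map-+ k []      = refl
rminFlags-map-+ k (x ∷ w) = cong₂ _∷_ (belowAll-+ w) (rminFlags-map-+ k w)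
  where
  belowAll-+ : ∀ ys → belowAll (x + k) (map (_+ k) ys) ≡ belowAll x ys
  belowAll-+ []       = refl
  belowAll-+ (y ∷ ys) rewrite +-cancelʳ-<ᵇ x y k | belowAll-+ ys = refl

marked-map : ∀ f w bs → marked (map f w) bs ≡ map (Maybe.map f) (marked w bs)
marked-map f []      bs           = refl
marked-map f (x ∷ w) []           = refl
marked-map f (x ∷ w) (true  ∷ bs) = cong (just (f x) ∷_) (marked-map f w bs)
marked-map f (x ∷ w) (false ∷ bs) = cong (nothing ∷_) (marked-map f w bs)

unmarked-map : ∀ f w bs → unmarked (map f w) bs ≡ map f (unmarked w bs)
unmarked-map f []      bs           = refl
unmarked-map f (x ∷ w) []           = refl
unmarked-map f (x ∷ w) (true  ∷ bs) = unmarked-map f w bs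
unmarked-map f (x ∷ w) (false ∷ bs) = cong (f x ∷_) (unmarked-map f w bs)

∈-unmarked⁻ : ∀ w bs {x} → x ∈ unmarked w bs → x ∈ w
∈-unmarked⁻ (y ∷ w) (true  ∷ bs) x∈         = there (∈-unmarked⁻ w bs x∈)
∈-unmarked⁻ (y ∷ w) (false ∷ bs) (here refl) = here refl
∈-unmarked⁻ (y ∷ w) (false ∷ bs) (there x∈) = there (∈-unmarked⁻ w bs x∈)

∈-nonRmins⁻ : ∀ w {x} → x ∈ nonRmins w → x ∈ w
∈-nonRmins⁻ w = ∈-unmarked⁻ w (rminFlags w)

module _ (a b : List ℕ) (a≤ : All (_≤ length a) a) (1≤b : All (1 ≤_) b) where

  rminFlags-⊕ : rminFlags (a ⊕ b) ≡ rminFlags a ++ rminFlags b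
  rminFlags-⊕ = begin
    rminFlags (a ++ map (_+ length a) b)              ≡⟨ rminFlags-++ a _ (All.map a-below-b a≤) ⟩
    rminFlags a ++ rminFlags (map (_+ length a) b)    ≡⟨ cong (rminFlags a ++_) (rminFlags-map-+ (length a) b) ⟩
    rminFlags a ++ rminFlags b                        ∎
    where
    open ≡-Reasoning
    a-below-b : ∀ {x} → x ≤ length a → belowAll x (map (_+ length a) b) ≡ true
    a-below-b x≤ = All⇒belowAll≡true _ _
      (All.map⁺ (All.map (λ 1≤y → ℕ.≤-trans (s≤s x≤) (ℕ.+-monoˡ-≤ (length a) 1≤y)) 1≤b))

  profile-⊕ : profile (a ⊕ b) ≡ profile a ++ map (Maybe.map (_+ length a)) (profile b)
  profile-⊕ = begin
    marked (a ⊕ b) (rminFlags (a ⊕ b))                         ≡⟨ cong (marked (a ⊕ b)) rminFlags-⊕ ⟩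
    marked (a ⊕ b) (rminFlags a ++ rminFlags b)                ≡⟨ marked-++ a _ _ _ (length-rminFlags a) ⟩
    profile a ++ marked (map (_+ length a) b) (rminFlags b)    ≡⟨ cong (profile a ++_) (marked-map _ b _) ⟩
    profile a ++ map (Maybe.map (_+ length a)) (profile b)     ∎
    where open ≡-Reasoning

  nonRmins-⊕ : nonRmins (a ⊕ b) ≡ nonRmins a ++ map (_+ length a) (nonRmins b)
  nonRmins-⊕ = begin
    unmarked (a ⊕ b) (rminFlags (a ⊕ b))                       ≡⟨ cong (unmarked (a ⊕ b)) rminFlags-⊕ ⟩
    unmarked (a ⊕ b) (rminFlags a ++ rminFlags b)              ≡⟨ unmarked-++ a _ _ _ (length-rminFlags a) ⟩
    nonRmins a ++ unmarked (map (_+ length a) b) (rminFlags b) ≡⟨ cong (nonRmins a ++_) (unmarked-map _ b _) ⟩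
    nonRmins a ++ map (_+ length a) (nonRmins b)               ∎
    where open ≡-Reasoning

  rprofile-⊕ : rprofile (a ⊕ b) ≡ map (Maybe.map (_+ length a)) (rprofile b) ++ rprofile a
  rprofile-⊕ rewrite profile-⊕
    | List.reverse-++ (profile a) (map (Maybe.map (_+ length a)) (profile b))
    | List.reverse-map (Maybe.map (_+ length a)) (profile b) = refl

module _ (L Z : List ℕ) (1∈Z : 1 ∈ Z) (1≤L : All (1 ≤_) L) where

  rminFlags-before-1 : rminFlags (L ++ Z) ≡ map (λ _ → false) L ++ rminFlags Z
  rminFlags-before-1 = go L 1≤L
    where
    go : ∀ L → All (1 ≤_) L → rminFlags (L ++ Z) ≡ map (λ _ → false) L ++ rminFlags Z
    go []      []          = refl
    go (x ∷ L) (1≤x ∷ 1≤L) = cong₂ _∷_ (∃≤⇒belowAll≡false x (L ++ Z) (∈-++⁺ʳ L 1∈Z) 1≤x) (go L 1≤L)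

  profile-before-1 : profile (L ++ Z) ≡ map (λ _ → nothing) L ++ profile Z
  profile-before-1 = trans (cong (marked (L ++ Z)) rminFlags-before-1) (go L)
    where
    go : ∀ L → marked (L ++ Z) (map (λ _ → false) L ++ rminFlags Z) ≡ map (λ _ → nothing) L ++ profile Z
    go []      = refl
    go (x ∷ L) = cong (nothing ∷_) (go L)

  nonRmins-before-1 : nonRmins (L ++ Z) ≡ L ++ nonRmins Z
  nonRmins-before-1 = trans (cong (unmarked (L ++ Z)) rminFlags-before-1) (go L)
    where
    go : ∀ L → unmarked (L ++ Z) (map (λ _ → false) L ++ rminFlags Z) ≡ L ++ nonRmins Z
    go []      = refl
    go (x ∷ L) = cong (x ∷_) (go L)

-- 0-based, and nothing when out of range.
entry : List (Maybe A) → ℕ → Maybe A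
entry []       _       = nothing
entry (x ∷ xs) zero    = x
entry (x ∷ xs) (suc i) = entry xs i

entry≡just⇒< : ∀ (xs : List (Maybe A)) i {v} → entry xs i ≡ just v → i < length xs
entry≡just⇒< (x ∷ xs) zero    e = s≤s z≤n
entry≡just⇒< (x ∷ xs) (suc i) e = s≤s (entry≡just⇒< xs i e)

entry-++ˡ : ∀ (xs ys : List (Maybe A)) i → i < length xs → entry (xs ++ ys) i ≡ entry xs i
entry-++ˡ (x ∷ xs) ys zero    _         = refl
entry-++ˡ (x ∷ xs) ys (suc i) (s≤s i<) = entry-++ˡ xs ys i i<

entry-++ʳ : ∀ (xs ys : List (Maybe A)) j → entry (xs ++ ys) (length xs + j) ≡ entry ys j
entry-++ʳ []       ys j = refl
entry-++ʳ (x ∷ xs) ys j = entry-++ʳ xs ys j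

entry-++⁻ : ∀ (xs ys : List (Maybe A)) i {v} → entry (xs ++ ys) i ≡ just v →
  entry xs i ≡ just v ⊎ ∃[ j ] i ≡ length xs + j × entry ys j ≡ just v
entry-++⁻ []       ys i       e = inj₂ (i , refl , e)
entry-++⁻ (x ∷ xs) ys zero    e = inj₁ e
entry-++⁻ (x ∷ xs) ys (suc i) e with entry-++⁻ xs ys i e
... | inj₁ e′              = inj₁ e′
... | inj₂ (j , refl , e′) = inj₂ (j , refl , e′)

entry-map : ∀ (f : A → A) xs i → entry (map (Maybe.map f) xs) i ≡ Maybe.map f (entry xs i)
entry-map f []       i       = refl
entry-map f (x ∷ xs) zero    = refl
entry-map f (x ∷ xs) (suc i) = entry-map f xs i

entry-map⁻ : ∀ (f : A → A) xs i {v} → entry (map (Maybe.map f) xs) i ≡ just v → ∃[ u ] entry xs i ≡ just u × f u ≡ v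
entry-map⁻ f xs i e with entry xs i | trans (sym (entry-map f xs i)) e
... | just u | refl = u , refl , refl

entry-∷ʳ-nothing : ∀ (xs : List (Maybe A)) i {v} → entry (xs ++ [ nothing ]) i ≡ just v → entry xs i ≡ just v
entry-∷ʳ-nothing []       zero    ()
entry-∷ʳ-nothing []       (suc i) ()
entry-∷ʳ-nothing (x ∷ xs) zero    e = e
entry-∷ʳ-nothing (x ∷ xs) (suc i) e = entry-∷ʳ-nothing xs i e

entry-reverse : ∀ (xs : List (Maybe A)) i → i < length xs → entry (reverse xs) i ≡ entry xs (length xs ∸ suc i)
entry-reverse (x ∷ xs) i i< rewrite List.unfold-reverse x xs with ℕ.m≤n⇒m<n∨m≡n (ℕ.≤-pred i<)
... | inj₁ i<n = trans (entry-++ˡ (reverse xs) [ x ] i (subst (i <_) (sym (List.length-reverse xs)) i<n))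
                  (trans (entry-reverse xs i i<n) (sym (cong (entry (x ∷ xs)) (ℕ.+-∸-assoc 1 i<n))))
... | inj₂ refl = trans (cong (entry (reverse xs ++ [ x ])) (trans (sym (List.length-reverse xs)) (sym (ℕ.+-identityʳ _))))
                   (trans (entry-++ʳ (reverse xs) [ x ] 0) (cong (entry (x ∷ xs)) (sym (ℕ.n∸n≡0 (length xs)))))

entry-ext : ∀ (xs ys : List (Maybe A)) → length xs ≡ length ys → (∀ j → entry xs j ≡ entry ys j) → xs ≡ ys
entry-ext []       []       _ _ = refl
entry-ext (x ∷ xs) (y ∷ ys) l h = cong₂ _∷_ (h 0) (entry-ext xs ys (ℕ.suc-injective l) (h ∘ suc))

at-∷ : ∀ x xs m → 1 ≤ m → at (x ∷ xs) (suc m) ≡ at xs m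
at-∷ x xs (suc m) _ = refl

All⇒at : ∀ {P : ℕ → Set} xs → All P xs → ∀ k → 1 ≤ k → k ≤ length xs → P (at xs k)
All⇒at (x ∷ xs) (px ∷ pxs) (suc zero)    _ _         = px
All⇒at (x ∷ xs) (px ∷ pxs) (suc (suc k)) _ (s≤s k≤) = All⇒at xs pxs (suc k) (s≤s z≤n) k≤

at⇒All : ∀ {P : ℕ → Set} xs → (∀ k → 1 ≤ k → k ≤ length xs → P (at xs k)) → All P xs
at⇒All []       h = []
at⇒All (y ∷ ys) h = h 1 (s≤s z≤n) (s≤s z≤n) ∷ at⇒All ys (λ { (suc k) _ k≤ → h (suc (suc k)) (s≤s z≤n) (s≤s k≤) })

at-∈ : ∀ w k → 1 ≤ k → k ≤ length w → at w k ∈ w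
at-∈ (x ∷ w) (suc zero)    _ _         = here refl
at-∈ (x ∷ w) (suc (suc k)) _ (s≤s k≤) = there (at-∈ w (suc k) (s≤s z≤n) k≤)

at-++ : ∀ P ys k → 1 ≤ k → at (P ++ ys) (length P + k) ≡ at ys k
at-++ []      ys k _   = refl
at-++ (p ∷ P) ys k 1≤k = trans (at-∷ p (P ++ ys) (length P + k) (ℕ.≤-trans 1≤k (ℕ.m≤n+m k (length P)))) (at-++ P ys k 1≤k)

∈⇒at : ∀ {z} Y → z ∈ Y → ∃[ k ] 1 ≤ k × k ≤ length Y × at Y k ≡ z
∈⇒at (y ∷ Y) (here refl) = 1 , s≤s z≤n , s≤s z≤n , refl
∈⇒at (y ∷ Y) (there z∈) with ∈⇒at Y z∈
... | suc k , _ , k≤ , e = suc (suc k) , s≤s z≤n , s≤s k≤ , e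

entry-marked-suc : ∀ x xs b fs j → entry (marked (x ∷ xs) (b ∷ fs)) (suc j) ≡ entry (marked xs fs) j
entry-marked-suc x xs true  fs j = refl
entry-marked-suc x xs false fs j = refl

RMIN⇒entry-profile : ∀ w j a → RMIN w (suc j) a → entry (profile w) j ≡ just a
RMIN⇒entry-profile (x ∷ xs) zero a (_ , _ , refl , x<later) =
  cong (λ b → entry (marked (x ∷ xs) (b ∷ rminFlags xs)) 0)
    (All⇒belowAll≡true x xs (at⇒All xs (λ { (suc k) _ k≤ → x<later (suc (suc k)) (s≤s (s≤s z≤n)) (s≤s k≤) })))
RMIN⇒entry-profile (x ∷ xs) (suc j) a (_ , s≤s j< , e , a<later) =
  trans (entry-marked-suc x xs (belowAll x xs) (rminFlags xs) j)
    (RMIN⇒entry-profile xs j a (s≤s z≤n , j< , e , λ { (suc k) k> k≤ → a<later (suc (suc k)) (s≤s k>) (s≤s k≤) }))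

entry-profile⇒RMIN : ∀ w j a → entry (profile w) j ≡ just a → RMIN w (suc j) a
entry-profile⇒RMIN (x ∷ xs) zero a e with belowAll x xs in x<xs
... | true  = s≤s z≤n , s≤s z≤n , just-injective e ,
  λ { (suc zero) (s≤s ()) _ ; (suc (suc k)) _ (s≤s k≤) →
    subst (_< _) (just-injective e) (All⇒at xs (belowAll≡true⇒All x xs x<xs) (suc k) (s≤s z≤n) k≤) }
entry-profile⇒RMIN (x ∷ xs) (suc j) a e
  with entry-profile⇒RMIN xs j a (trans (sym (entry-marked-suc x xs (belowAll x xs) (rminFlags xs) j)) e)
... | _ , j≤ , e′ , a<later = s≤s z≤n , s≤s j≤ , e′ , λ { (suc (suc k)) (s≤s k>) (s≤s k≤) → a<later (suc k) k> k≤ }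

RMIN⇔entry-rprofile : ∀ {n} w i a → length w ≡ n → 1 ≤ i → i ≤ n →
  RMIN w (n + 1 ∸ i) a ⇔ (entry (rprofile w) (i ∸ 1) ≡ just a)
RMIN⇔entry-rprofile {n} w (suc i) a len _ i≤n = mk⇔
  (λ r → trans reversed (RMIN⇒entry-profile w (n ∸ suc i) a (subst (λ p → RMIN w p a) position r)))
  (λ e → subst (λ p → RMIN w p a) (sym position) (entry-profile⇒RMIN w (n ∸ suc i) a (trans (sym reversed) e)))
  where
  position : n + 1 ∸ suc i ≡ suc (n ∸ suc i)
  position = trans (cong (_∸ suc i) (ℕ.+-comm n 1)) (ℕ.+-∸-assoc 1 i≤n)
  reversed : entry (rprofile w) i ≡ entry (profile w) (n ∸ suc i)
  reversed = trans (entry-reverse (profile w) i (subst (i <_) (sym (trans (length-profile w) len)) i≤n))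
    (cong (λ l → entry (profile w) (l ∸ suc i)) (trans (length-profile w) len))

-- Transposed profiles

-- X, read as a partial map from 0-based indices to 1-based values, is
-- contained in the inverse of Y.
Transposed : List (Maybe ℕ) → List (Maybe ℕ) → Set
Transposed X Y = ∀ i v → entry X i ≡ just v → ∃[ a ] v ≡ suc a × entry Y a ≡ just (suc i)

transposed-[] : Transposed [] []
transposed-[] i v ()

transposed-[1] : Transposed [ just 1 ] [ just 1 ]
transposed-[1] zero    .1 refl = 0 , refl , refl
transposed-[1] (suc i) v  ()

transposed-∷ʳ-nothing : ∀ {X Y} → Transposed X Y → Transposed (X ++ [ nothing ]) (Y ++ [ nothing ])
transposed-∷ʳ-nothing {X} {Y} t i v e with t i v (entry-∷ʳ-nothing X i e)
... | a , refl , e′ = a , refl , trans (entry-++ˡ Y _ a (entry≡just⇒< Y a e′)) e′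

-- Swapping the two blocks of a direct sum: the block that comes first in
-- X comes last in Y, so each is shifted by the length of the other.
transposed-⊕ : ∀ {X₁ X₂ Y₁ Y₂} k l → length X₂ ≡ l → length Y₁ ≡ k →
  Transposed X₁ Y₁ → Transposed X₂ Y₂ →
  Transposed (map (Maybe.map (_+ k)) X₂ ++ X₁) (map (Maybe.map (_+ l)) Y₁ ++ Y₂)
transposed-⊕ {X₁} {X₂} {Y₁} {Y₂} k l |X₂| |Y₁| t₁ t₂ i v e
  with entry-++⁻ (map (Maybe.map (_+ k)) X₂) X₁ i e
... | inj₁ e₂ with entry-map⁻ (_+ k) X₂ i e₂
...   | v₂ , e₂′ , refl with t₂ i v₂ e₂′
...     | a , refl , e₂″ = a + k , refl , (begin
  entry (Y₁′ ++ Y₂) (a + k)             ≡⟨ cong (entry (Y₁′ ++ Y₂)) (trans (ℕ.+-comm a k) (cong (_+ a) (sym |Y₁′|))) ⟩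
  entry (Y₁′ ++ Y₂) (length Y₁′ + a)    ≡⟨ entry-++ʳ Y₁′ Y₂ a ⟩
  entry Y₂ a                            ≡⟨ e₂″ ⟩
  just (suc i)                          ∎)
  where
  open ≡-Reasoning
  Y₁′ = map (Maybe.map (_+ l)) Y₁
  |Y₁′| : length Y₁′ ≡ k
  |Y₁′| = trans (List.length-map _ Y₁) |Y₁|
transposed-⊕ {X₁} {X₂} {Y₁} {Y₂} k l |X₂| |Y₁| t₁ t₂ i v e
    | inj₂ (j , refl , e₁) with t₁ j v e₁
... | a , refl , e₁′ = a , refl , (begin
  entry (Y₁′ ++ Y₂) a                   ≡⟨ entry-++ˡ Y₁′ Y₂ a a<|Y₁′| ⟩
  entry Y₁′ a                           ≡⟨ entry-map (_+ l) Y₁ a ⟩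
  Maybe.map (_+ l) (entry Y₁ a)         ≡⟨ cong (Maybe.map (_+ l)) e₁′ ⟩
  just (suc (j + l))                    ≡⟨ cong (λ m → just (suc m)) (trans (ℕ.+-comm j l) (cong (_+ j) (sym |X₂′|))) ⟩
  just (suc (length X₂′ + j))           ∎)
  where
  open ≡-Reasoning
  Y₁′ = map (Maybe.map (_+ l)) Y₁
  X₂′ = map (Maybe.map (_+ k)) X₂
  a<|Y₁′| : a < length Y₁′
  a<|Y₁′| = subst (a <_) (sym (List.length-map _ Y₁)) (entry≡just⇒< Y₁ a e₁′)
  |X₂′| : length X₂′ ≡ l
  |X₂′| = trans (List.length-map _ X₂) |X₂|

RminDuality : ℕ → List ℕ → List ℕ → Set
RminDuality n π σ = ∀ i a → 1 ≤ i → i ≤ n → 1 ≤ a → a ≤ n → (RMIN π (n + 1 ∸ i) a ⇔ RMIN σ (n + 1 ∸ a) i)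

transposed⇒RMIN : ∀ {n} w₁ w₂ → length w₁ ≡ n → length w₂ ≡ n → Transposed (rprofile w₁) (rprofile w₂) →
  ∀ i a → 1 ≤ i → i ≤ n → 1 ≤ a → a ≤ n → RMIN w₁ (n + 1 ∸ i) a → RMIN w₂ (n + 1 ∸ a) i
transposed⇒RMIN w₁ w₂ |w₁| |w₂| t (suc i) a 1≤i i≤n 1≤a a≤n r
  with t i a (Equivalence.to (RMIN⇔entry-rprofile w₁ (suc i) a |w₁| 1≤i i≤n) r)
... | a′ , refl , e = Equivalence.from (RMIN⇔entry-rprofile w₂ (suc a′) (suc i) |w₂| 1≤a a≤n) e

record Corresponds (n : ℕ) (π σ : List ℕ) : Set where
  field
    isPerm              : IsPerm n σ
    nonRmins-increasing : Increasing (nonRmins σ)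
    transposed          : Transposed (rprofile π) (rprofile σ)
    transposed⁻¹        : Transposed (rprofile σ) (rprofile π)

corresponds⇒duality : ∀ {n π σ} → IsPerm n π → Corresponds n π σ → RminDuality n π σ
corresponds⇒duality {π = π} {σ} π-perm c i a 1≤i i≤n 1≤a a≤n = mk⇔
  (transposed⇒RMIN π σ |π| |σ| transposed i a 1≤i i≤n 1≤a a≤n)
  (transposed⇒RMIN σ π |σ| |π| transposed⁻¹ a i 1≤a a≤n 1≤i i≤n)
  where
  open Corresponds c
  |π| = isPerm-length π-perm
  |σ| = isPerm-length isPerm

corresponds-[] : Corresponds 0 [] []
corresponds-[] = record
  { isPerm = ↭-refl ; nonRmins-increasing = [] ; transposed = transposed-[] ; transposed⁻¹ = transposed-[] }

corresponds-⊕ : ∀ {k l π₁ π₂ σ₁ σ₂} → IsPerm k π₁ → IsPerm l π₂ →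
  Corresponds k π₁ σ₁ → Corresponds l π₂ σ₂ → Corresponds (k + l) (π₁ ⊕ π₂) (σ₂ ⊕ σ₁)
corresponds-⊕ {k} {l} {π₁} {π₂} {σ₁} {σ₂} π₁-perm π₂-perm c₁ c₂ = record
  { isPerm              = subst (λ m → IsPerm m (σ₂ ⊕ σ₁)) (ℕ.+-comm l k) (isPerm-⊕ σ₂-perm σ₁-perm)
  ; nonRmins-increasing = increasing
  ; transposed          = subst₂ Transposed (sym rπ) (sym rσ)
      (transposed-⊕ {rprofile π₁} {rprofile π₂} {rprofile σ₁} {rprofile σ₂}
        (length π₁) (length σ₂) |rπ₂| |rσ₁| (C.transposed c₁) (C.transposed c₂))
  ; transposed⁻¹        = subst₂ Transposed (sym rσ) (sym rπ)
      (transposed-⊕ {rprofile σ₂} {rprofile σ₁} {rprofile π₂} {rprofile π₁}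
        (length σ₂) (length π₁) |rσ₁| |rπ₂| (C.transposed⁻¹ c₂) (C.transposed⁻¹ c₁))
  }
  where
  module C = Corresponds
  σ₁-perm = C.isPerm c₁
  σ₂-perm = C.isPerm c₂
  rπ = rprofile-⊕ π₁ π₂ (isPerm-≤length π₁-perm) (isPerm-positive π₂-perm)
  rσ = rprofile-⊕ σ₂ σ₁ (isPerm-≤length σ₂-perm) (isPerm-positive σ₁-perm)
  |rπ₂| : length (rprofile π₂) ≡ length σ₂
  |rπ₂| = trans (length-rprofile π₂) (trans (isPerm-length π₂-perm) (sym (isPerm-length σ₂-perm)))
  |rσ₁| : length (rprofile σ₁) ≡ length π₁
  |rσ₁| = trans (length-rprofile σ₁) (trans (isPerm-length σ₁-perm) (sym (isPerm-length π₁-perm)))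
  increasing : Increasing (nonRmins (σ₂ ⊕ σ₁))
  increasing rewrite nonRmins-⊕ σ₂ σ₁ (isPerm-≤length σ₂-perm) (isPerm-positive σ₁-perm) =
    AllPairs.++⁺ (C.nonRmins-increasing c₂)
      (AllPairs.map⁺ (AllPairs.map (ℕ.+-monoˡ-< (length σ₂)) (C.nonRmins-increasing c₁)))
      (All.tabulate λ x∈ → All.tabulate λ y∈ → below (All.lookup (isPerm-≤length σ₂-perm) (∈-nonRmins⁻ σ₂ x∈)) y∈)
    where
    below : ∀ {x y} → x ≤ length σ₂ → y ∈ map (_+ length σ₂) (nonRmins σ₁) → x < y
    below x≤ y∈ with ∈-map⁻ _ y∈
    ... | y′ , y′∈ , refl =
      ℕ.≤-trans (s≤s x≤) (ℕ.+-monoˡ-≤ (length σ₂) (All.lookup (isPerm-positive σ₁-perm) (∈-nonRmins⁻ σ₁ y′∈)))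

allUnboxed : List ℕ → List (ℕ × Bool)
allUnboxed = map (_, false)

-- pre is the part of the word read so far, reversed.
lrMaxNotRmin : List ℕ → ℕ → List ℕ → Bool
lrMaxNotRmin pre x xs = allB (_<ᵇ x) pre ∧ not (belowAll x xs)

annotAfterOne : List ℕ → List ℕ → List (ℕ × Bool)
annotAfterOne pre []       = []
annotAfterOne pre (x ∷ xs) = (x , lrMaxNotRmin pre x xs) ∷ annotAfterOne (x ∷ pre) xs

map-proj₁-annotAfterOne : ∀ pre R → map proj₁ (annotAfterOne pre R) ≡ R
map-proj₁-annotAfterOne pre []      = refl
map-proj₁-annotAfterOne pre (x ∷ R) = cong (x ∷_) (map-proj₁-annotAfterOne (x ∷ pre) R)

NotOne : List ℕ → Set
NotOne = All (λ x → isOne x ≡ false)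

anyB-isOne-∷ : ∀ x pre → isOne x ≡ false → anyB isOne (x ∷ pre) ≡ anyB isOne pre
anyB-isOne-∷ x pre x≢1 = cong (λ b → if b then true else anyB isOne pre) x≢1

module _ (m : ℕ) where

  annot-∷ : ∀ {s} pre x xs → isOne x ≡ false → anyB isOne pre ≡ s →
    annot m pre (x ∷ xs) ≡ (x , s ∧ lrMaxNotRmin pre x xs) ∷ annot m (x ∷ pre) xs
  annot-∷ pre x xs x≢1 refl = cong (λ b → if b then (m , true) ∷ rest else rest) x≢1
    where rest = (x , anyB isOne pre ∧ lrMaxNotRmin pre x xs) ∷ annot m (x ∷ pre) xs

  annot-before-1 : ∀ pre L ys → NotOne L → anyB isOne pre ≡ false →
    annot m pre (L ++ ys) ≡ allUnboxed L ++ annot m (reverse L ++ pre) ys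
  annot-before-1 pre []      ys []          _   = refl
  annot-before-1 pre (x ∷ L) ys (x≢1 ∷ L≢1) no1 = begin
    annot m pre (x ∷ L ++ ys)                                  ≡⟨ annot-∷ pre x (L ++ ys) x≢1 no1 ⟩
    (x , false) ∷ annot m (x ∷ pre) (L ++ ys)                  ≡⟨ cong ((x , false) ∷_) (annot-before-1 (x ∷ pre) L ys L≢1 no1′) ⟩
    (x , false) ∷ allUnboxed L ++ annot m (reverse L ++ x ∷ pre) ys
                                                               ≡⟨ cong (λ z → (x , false) ∷ allUnboxed L ++ annot m z ys) (sym reverse-∷) ⟩
    allUnboxed (x ∷ L) ++ annot m (reverse (x ∷ L) ++ pre) ys  ∎
    where
    open ≡-Reasoning
    no1′ = trans (anyB-isOne-∷ x pre x≢1) no1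
    reverse-∷ : reverse (x ∷ L) ++ pre ≡ reverse L ++ x ∷ pre
    reverse-∷ = trans (cong (_++ pre) (List.unfold-reverse x L)) (List.++-assoc (reverse L) [ x ] pre)

  annot-at-1 : ∀ pre R → anyB isOne pre ≡ false →
    annot m pre (1 ∷ R) ≡ (m , true) ∷ (1 , false) ∷ annot m (1 ∷ pre) R
  annot-at-1 pre R no1 = cong (λ b → (m , true) ∷ (1 , b ∧ lrMaxNotRmin pre 1 R) ∷ annot m (1 ∷ pre) R) no1

  annot-after-1 : ∀ pre R → anyB isOne pre ≡ true → NotOne R → annot m pre R ≡ annotAfterOne pre R
  annot-after-1 pre []      _   []          = refl
  annot-after-1 pre (x ∷ R) one (x≢1 ∷ R≢1) =
    trans (annot-∷ pre x R x≢1 one)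
      (cong (_ ∷_) (annot-after-1 (x ∷ pre) R (trans (anyB-isOne-∷ x pre x≢1) one) R≢1))

-- rotate v r: the boxed letters of r move one boxed slot to the left; the
-- first one leaves at the front and v enters the last boxed slot.
rotate : ℕ → List (ℕ × Bool) → ℕ × List ℕ
rotate v []                = v , []
rotate v ((x , false) ∷ r) = proj₁ (rotate v r) , x ∷ proj₂ (rotate v r)
rotate v ((x , true)  ∷ r) = x , proj₁ (rotate v r) ∷ proj₂ (rotate v r)

refill-allUnboxed : ∀ L ws cs → refill (allUnboxed L ++ ws) cs ≡ L ++ refill ws cs
refill-allUnboxed []      ws []       = refl
refill-allUnboxed []      ws (c ∷ cs) = refl
refill-allUnboxed (x ∷ L) ws []       = cong (x ∷_) (refill-allUnboxed L ws [])
refill-allUnboxed (x ∷ L) ws (c ∷ cs) = cong (x ∷_) (refill-allUnboxed L ws (c ∷ cs))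

boxedVals-allUnboxed : ∀ L ws → boxedVals (allUnboxed L ++ ws) ≡ boxedVals ws
boxedVals-allUnboxed []      ws = refl
boxedVals-allUnboxed (x ∷ L) ws = boxedVals-allUnboxed L ws

refill-boxed-unboxed : ∀ y x r cs {c t} → refill ((y , true) ∷ r) cs ≡ c ∷ t →
  refill ((y , true) ∷ (x , false) ∷ r) cs ≡ c ∷ x ∷ t
refill-boxed-unboxed y x r []       e with List.∷-injective e
... | refl , refl = refl
refill-boxed-unboxed y x r (d ∷ cs) e with List.∷-injective e
... | refl , refl = refl

refill-rotate : ∀ r v y → refill ((y , true) ∷ r) (boxedVals r ++ [ v ]) ≡ proj₁ (rotate v r) ∷ proj₂ (rotate v r)
refill-rotate []                v y = refl
refill-rotate ((x , false) ∷ r) v y = refill-boxed-unboxed y x r (boxedVals r ++ [ v ]) (refill-rotate r v y)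
refill-rotate ((x , true)  ∷ r) v y = cong (x ∷_) (refill-rotate r v x)

anyB-isOne-reverse : ∀ L → NotOne L → anyB isOne (reverse L ++ []) ≡ false
anyB-isOne-reverse L L≢1 = go (reverse L ++ []) (All.++⁺ (All.tabulate (All.lookup L≢1 ∘ Any.reverse⁻)) [])
  where
  go : ∀ xs → NotOne xs → anyB isOne xs ≡ false
  go []       []          = refl
  go (x ∷ xs) (x≢1 ∷ xs≢1) = trans (anyB-isOne-∷ x xs x≢1) (go xs xs≢1)

rotateLeft : List ℕ → List ℕ
rotateLeft cs = drop 1 cs ++ take 1 cs

β-nonempty : ∀ τ → ¬ τ ≡ [] →
  β τ ≡ refill (annot (suc (length τ)) [] τ) (rotateLeft (boxedVals (annot (suc (length τ)) [] τ)))
β-nonempty []      τ≢[] = ⊥-elim (τ≢[] refl)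
β-nonempty (_ ∷ _) _    = refl

β-split : ∀ L R → NotOne L → NotOne R →
  let m = suc (length (L ++ 1 ∷ R)) ; r = annotAfterOne (1 ∷ reverse L ++ []) R
  in β (L ++ 1 ∷ R) ≡ L ++ proj₁ (rotate m r) ∷ 1 ∷ proj₂ (rotate m r)
β-split L R L≢1 R≢1 = begin
  β ρ                                                     ≡⟨ β-nonempty ρ (λ e → case List.++-conicalʳ L (1 ∷ R) e of λ ()) ⟩
  refill (annot m [] ρ) (rotateLeft (boxedVals (annot m [] ρ)))
                                                          ≡⟨ cong (λ ws → refill ws (rotateLeft (boxedVals ws))) annot-ρ ⟩
  refill ws (rotateLeft (boxedVals ws))                   ≡⟨ cong (refill ws ∘ rotateLeft) (boxedVals-allUnboxed L _) ⟩
  refill ws (boxedVals r ++ [ m ])                        ≡⟨ refill-allUnboxed L _ _ ⟩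
  L ++ refill ((m , true) ∷ (1 , false) ∷ r) (boxedVals r ++ [ m ])
                                                          ≡⟨ cong (L ++_) (refill-boxed-unboxed m 1 r _ (refill-rotate r m m)) ⟩
  L ++ proj₁ (rotate m r) ∷ 1 ∷ proj₂ (rotate m r)        ∎
  where
  open ≡-Reasoning
  ρ = L ++ 1 ∷ R
  m = suc (length ρ)
  r = annotAfterOne (1 ∷ reverse L ++ []) R
  ws = allUnboxed L ++ (m , true) ∷ (1 , false) ∷ r
  annot-ρ : annot m [] ρ ≡ ws
  annot-ρ = trans (annot-before-1 m [] L (1 ∷ R) L≢1 refl)
    (cong (allUnboxed L ++_) (trans (annot-at-1 m (reverse L ++ []) R (anyB-isOne-reverse L L≢1))
      (cong (λ z → (m , true) ∷ (1 , false) ∷ z) (annot-after-1 m (1 ∷ reverse L ++ []) R refl R≢1))))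

-- E holds the letters preceding the annotated word.
data WellBoxed (E : List ℕ) : List (ℕ × Bool) → Set where
  []      : WellBoxed E []
  boxed   : ∀ {x r} → All (_< x) E → ∃[ y ] y ∈ map proj₁ r × y ≤ x →
            WellBoxed (x ∷ E) r → WellBoxed E ((x , true) ∷ r)
  unboxed : ∀ {x r} → All (x <_) (map proj₁ r) →
            WellBoxed (x ∷ E) r → WellBoxed E ((x , false) ∷ r)

isUnboxed : ℕ × Bool → Bool
isUnboxed = not ∘ proj₂

wellBoxed-above : ∀ {E r z} → WellBoxed E r → z ∈ E → All (z <_) (boxedVals r)
wellBoxed-above []               z∈ = []
wellBoxed-above (boxed E<x _ wb) z∈ = All.lookup E<x z∈ ∷ wellBoxed-above wb (there z∈)
wellBoxed-above (unboxed _ wb)   z∈ = wellBoxed-above wb (there z∈)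

wellBoxed-increasing : ∀ {E r} → WellBoxed E r → Increasing (boxedVals r)
wellBoxed-increasing []             = []
wellBoxed-increasing (boxed _ _ wb) = wellBoxed-above wb (here refl) ∷ wellBoxed-increasing wb
wellBoxed-increasing (unboxed _ wb) = wellBoxed-increasing wb

∈-map-proj₁⁻ : ∀ {y : ℕ} (r : List (ℕ × Bool)) → y ∈ map proj₁ r → ∃[ b ] (y , b) ∈ r
∈-map-proj₁⁻ r y∈ with ∈-map⁻ proj₁ y∈
... | (_ , b) , yb∈ , refl = b , yb∈

∈-boxedVals⁺ : ∀ {y : ℕ} (r : List (ℕ × Bool)) → (y , true) ∈ r → y ∈ boxedVals r
∈-boxedVals⁺ ((x , true)  ∷ r) (here refl) = here refl
∈-boxedVals⁺ ((x , true)  ∷ r) (there y∈)  = there (∈-boxedVals⁺ r y∈)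
∈-boxedVals⁺ ((x , false) ∷ r) (there y∈)  = ∈-boxedVals⁺ r y∈

∈-boxedVals⁻ : ∀ {y : ℕ} (r : List (ℕ × Bool)) → y ∈ boxedVals r → y ∈ map proj₁ r
∈-boxedVals⁻ ((x , true)  ∷ r) (here refl) = here refl
∈-boxedVals⁻ ((x , true)  ∷ r) (there y∈)  = there (∈-boxedVals⁻ r y∈)
∈-boxedVals⁻ ((x , false) ∷ r) y∈          = there (∈-boxedVals⁻ r y∈)

rotate-↭ : ∀ v r → proj₁ (rotate v r) ∷ proj₂ (rotate v r) ↭ v ∷ map proj₁ r
rotate-↭ v []                = ↭-refl
rotate-↭ v ((x , false) ∷ r) = ↭-trans (swap _ x ↭-refl) (↭-trans (prep x (rotate-↭ v r)) (swap x v ↭-refl))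
rotate-↭ v ((x , true)  ∷ r) = ↭-trans (prep x (rotate-↭ v r)) (swap x v ↭-refl)

rotate-All : ∀ {P : ℕ → Set} v r → All P (v ∷ map proj₁ r) → All P (proj₁ (rotate v r) ∷ proj₂ (rotate v r))
rotate-All v r = ↭.All-resp-↭ (↭-sym (rotate-↭ v r))

rotate-head : ∀ {P : ℕ → Set} v r → All P (v ∷ boxedVals r) → P (proj₁ (rotate v r))
rotate-head v []                (pv ∷ _)      = pv
rotate-head v ((x , false) ∷ r) pvs           = rotate-head v r pvs
rotate-head v ((x , true)  ∷ r) (_ ∷ px ∷ _) = px

∈-rotate-unboxed : ∀ {y : ℕ} v (r : List (ℕ × Bool)) → (y , false) ∈ r → y ∈ proj₂ (rotate v r)
∈-rotate-unboxed v ((x , false) ∷ r) (here refl) = here refl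
∈-rotate-unboxed v ((x , false) ∷ r) (there y∈)  = there (∈-rotate-unboxed v r y∈)
∈-rotate-unboxed v ((x , true)  ∷ r) (there y∈)  = there (∈-rotate-unboxed v r y∈)

rminFlags-wellBoxed : ∀ {E r} → WellBoxed E r → rminFlags (map proj₁ r) ≡ map isUnboxed r
rminFlags-wellBoxed []                              = refl
rminFlags-wellBoxed (boxed {x} _ (y , y∈ , y≤x) wb) = cong₂ _∷_ (∃≤⇒belowAll≡false x _ y∈ y≤x) (rminFlags-wellBoxed wb)
rminFlags-wellBoxed (unboxed {x} x<r wb)            = cong₂ _∷_ (All⇒belowAll≡true x _ x<r) (rminFlags-wellBoxed wb)

-- Rotation keeps every right-to-left minimum in place: the letters moved
-- into boxed slots only grow, and each boxed slot keeps a smaller unboxed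
-- letter to its right.
rminFlags-rotate : ∀ {E r} v → WellBoxed E r → All (_< v) (map proj₁ r) →
  rminFlags (proj₂ (rotate v r)) ≡ map isUnboxed r
rminFlags-rotate v [] _ = refl
rminFlags-rotate v (unboxed {x} {r} x<r wb) (x<v ∷ r<v) =
  cong₂ _∷_ (All⇒belowAll≡true x _ (All.tail (rotate-All v r (x<v ∷ x<r)))) (rminFlags-rotate v wb r<v)
rminFlags-rotate v (boxed {x} {r} _ (y , y∈ , y≤x) wb) (x<v ∷ r<v) =
  cong₂ _∷_ (smaller-follows (∈-map-proj₁⁻ r y∈)) (rminFlags-rotate v wb r<v)
  where
  x<head : x < proj₁ (rotate v r)
  x<head = rotate-head v r (x<v ∷ wellBoxed-above wb (here refl))
  smaller-follows : ∃[ b ] (y , b) ∈ r → belowAll (proj₁ (rotate v r)) (proj₂ (rotate v r)) ≡ false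
  smaller-follows (true  , y∈′) = ⊥-elim (ℕ.<⇒≱ (All.lookup (wellBoxed-above wb (here refl)) (∈-boxedVals⁺ r y∈′)) y≤x)
  smaller-follows (false , y∈′) = ∃≤⇒belowAll≡false _ _ (∈-rotate-unboxed v r y∈′) (ℕ.<⇒≤ (ℕ.≤-<-trans y≤x x<head))

marked-rotate : ∀ v r → marked (map proj₁ r) (map isUnboxed r) ≡ marked (proj₂ (rotate v r)) (map isUnboxed r)
marked-rotate v []                = refl
marked-rotate v ((x , false) ∷ r) = cong (just x ∷_) (marked-rotate v r)
marked-rotate v ((x , true)  ∷ r) = cong (nothing ∷_) (marked-rotate v r)

unmarked-rotate : ∀ v r → proj₁ (rotate v r) ∷ unmarked (proj₂ (rotate v r)) (map isUnboxed r) ≡ boxedVals r ++ [ v ]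
unmarked-rotate v []                = refl
unmarked-rotate v ((x , false) ∷ r) = unmarked-rotate v r
unmarked-rotate v ((x , true)  ∷ r) = cong (x ∷_) (unmarked-rotate v r)

∈-nonRmins-++⁺ʳ : ∀ P ys {x} → x ∈ nonRmins ys → x ∈ nonRmins (P ++ ys)
∈-nonRmins-++⁺ʳ []      ys x∈ = x∈
∈-nonRmins-++⁺ʳ (p ∷ P) ys x∈ with belowAll p (P ++ ys)
... | true  = ∈-nonRmins-++⁺ʳ P ys x∈
... | false = there (∈-nonRmins-++⁺ʳ P ys x∈)

nonRmins-increasing-∷ : ∀ p rest → Increasing (nonRmins (p ∷ rest)) → Increasing (nonRmins rest)
nonRmins-increasing-∷ p rest incr = go (belowAll p rest) refl
  where
  go : ∀ b → belowAll p rest ≡ b → Increasing (nonRmins rest)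
  go true  e = subst Increasing (nonRmins-∷-rmin p rest e) incr
  go false e = AllPairs.tail (subst Increasing (nonRmins-∷-nonrmin p rest e) incr)

-- In a pattern z … x … y with z ≥ x ≥ y neither z nor x is a right-to-left
-- minimum, so z would precede the not-larger x among the non-minima.
increasing-nonRmins⇒no-321 : ∀ P x X {z y} → Increasing (nonRmins (P ++ x ∷ X)) →
  z ∈ P → x ≤ z → y ∈ X → y ≤ x → ⊥
increasing-nonRmins⇒no-321 (p ∷ P) x X incr (here refl) x≤p y∈ y≤x =
  ℕ.<⇒≱ (All.lookup p<later (∈-nonRmins-++⁺ʳ P (x ∷ X) x∈)) x≤p
  where
  p-nonrmin : belowAll p (P ++ x ∷ X) ≡ false
  p-nonrmin = ∃≤⇒belowAll≡false p (P ++ x ∷ X) (∈-++⁺ʳ P (here refl)) x≤p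
  p<later : All (p <_) (nonRmins (P ++ x ∷ X))
  p<later = AllPairs.head (subst Increasing (nonRmins-∷-nonrmin p (P ++ x ∷ X) p-nonrmin) incr)
  x∈ : x ∈ nonRmins (x ∷ X)
  x∈ = subst (x ∈_) (sym (nonRmins-∷-nonrmin x X (∃≤⇒belowAll≡false x X y∈ y≤x))) (here refl)
increasing-nonRmins⇒no-321 (p ∷ P) x X incr (there z∈) x≤z y∈ y≤x =
  increasing-nonRmins⇒no-321 P x X (nonRmins-increasing-∷ p (P ++ x ∷ X) incr) z∈ x≤z y∈ y≤x

wellBoxed-annotAfterOne : ∀ P pre R → (∀ {z} → z ∈ pre → z ∈ P) → Increasing (nonRmins (P ++ R)) →
  WellBoxed pre (annotAfterOne pre R)
wellBoxed-annotAfterOne P pre []       _      _    = []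
wellBoxed-annotAfterOne P pre (x ∷ xs) pre⊆P incr = step (lrMaxNotRmin pre x xs) refl
  where
  rest : WellBoxed (x ∷ pre) (annotAfterOne (x ∷ pre) xs)
  rest = wellBoxed-annotAfterOne (P ++ [ x ]) (x ∷ pre) xs
    (λ { (here refl) → ∈-++⁺ʳ P (here refl) ; (there z∈) → ∈-++⁺ˡ (pre⊆P z∈) })
    (subst (Increasing ∘ nonRmins) (sym (List.++-assoc P [ x ] xs)) incr)
  xs≡ : map proj₁ (annotAfterOne (x ∷ pre) xs) ≡ xs
  xs≡ = map-proj₁-annotAfterOne (x ∷ pre) xs
  step : ∀ b → lrMaxNotRmin pre x xs ≡ b → WellBoxed pre ((x , b) ∷ annotAfterOne (x ∷ pre) xs)
  step true e with belowAll≡false⇒∃≤ x xs (trans (sym (not-involutive _)) (cong not (∧-conicalʳ _ _ e)))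
  ... | y , y∈ , y≤x = boxed
    (All.map <ᵇ≡true⇒< (allB≡true⇒All (_<ᵇ x) pre (∧-conicalˡ _ _ e)))
    (y , subst (y ∈_) (sym xs≡) y∈ , y≤x) rest
  step false e = unboxed (subst (All (x <_)) (sym xs≡) (x<xs (belowAll x xs) refl)) rest
    where
    -- Otherwise x is neither a right-to-left minimum nor a left-to-right
    -- maximum, and with a larger earlier and a smaller later letter forms a 321.
    x<xs : ∀ b → belowAll x xs ≡ b → All (x <_) xs
    x<xs true  x<ᵇxs = belowAll≡true⇒All x xs x<ᵇxs
    x<xs false x≮ᵇxs with belowAll≡false⇒∃≤ x xs x≮ᵇxs
    ... | y , y∈ , y≤x
      with find (allB≡false⇒Any (_<ᵇ x) pre
             (trans (sym (∧-identityʳ _)) (trans (cong (λ b → allB (_<ᵇ x) pre ∧ not b) (sym x≮ᵇxs)) e)))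
    ... | z , z∈ , z≮ᵇx = ⊥-elim (increasing-nonRmins⇒no-321 P x xs incr (pre⊆P z∈) (<ᵇ≡false⇒≥ z≮ᵇx) y∈ y≤x)

-- β preserves the correspondence

module β-step {n : ℕ} (L R : List ℕ) (ρ-perm : IsPerm n (L ++ 1 ∷ R))
              (ρ-increasing : Increasing (nonRmins (L ++ 1 ∷ R))) where

  ρ = L ++ 1 ∷ R
  m = suc (length ρ)
  r = annotAfterOne (1 ∷ reverse L ++ []) R
  h = proj₁ (rotate m r)
  R′ = proj₂ (rotate m r)

  private
    m≡1+n : m ≡ suc n
    m≡1+n = cong suc (isPerm-length ρ-perm)

    L-bounds : All (λ x → 1 ≤ x × x ≤ n) L
    L-bounds = All.++⁻ˡ L (isPerm-bounds ρ-perm)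

    R-bounds : All (λ x → 1 ≤ x × x ≤ n) R
    R-bounds = All.tail (All.++⁻ʳ L (isPerm-bounds ρ-perm))

    ≤n⇒<m : ∀ {x} → x ≤ n → x < m
    ≤n⇒<m x≤n = s≤s (subst (_ ≤_) (sym (isPerm-length ρ-perm)) x≤n)

    1∉L : All (λ x → ¬ x ≡ 1) L
    1∉L = proj₁ (unique-middle L {1} {R} (isPerm-unique ρ-perm))

    1∉R : All (λ x → ¬ 1 ≡ x) R
    1∉R = proj₂ (unique-middle L {1} {R} (isPerm-unique ρ-perm))

    L-notOne : NotOne L
    L-notOne = All.map ≢⇒≡ᵇ≡false 1∉L

    R-notOne : NotOne R
    R-notOne = All.map (λ 1≢x → ≢⇒≡ᵇ≡false (1≢x ∘ sym)) 1∉R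

    1<R : All (1 <_) R
    1<R = All.zipWith (λ { ((1≤x , _) , 1≢x) → ℕ.≤∧≢⇒< 1≤x 1≢x }) (R-bounds , 1∉R)

    1≤L : All (1 ≤_) L
    1≤L = All.map proj₁ L-bounds

    1<m : 1 < m
    1<m = s≤s (subst (1 ≤_) (sym (List.length-++ L)) (ℕ.≤-trans (s≤s z≤n) (ℕ.m≤n+m (suc (length R)) (length L))))

    R≡ : map proj₁ r ≡ R
    R≡ = map-proj₁-annotAfterOne _ R

    r<m : All (_< m) (map proj₁ r)
    r<m = subst (All (_< m)) (sym R≡) (All.map (≤n⇒<m ∘ proj₂) R-bounds)

    r-wellBoxed : WellBoxed (1 ∷ reverse L ++ []) r
    r-wellBoxed = wellBoxed-annotAfterOne (L ++ [ 1 ]) (1 ∷ reverse L ++ []) R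
      (λ { (here refl) → ∈-++⁺ʳ L (here refl)
         ; (there z∈) → ∈-++⁺ˡ {ys = [ 1 ]} (Any.reverse⁻ {xs = L} (subst (_ ∈_) (List.++-identityʳ (reverse L)) z∈)) })
      (subst (Increasing ∘ nonRmins) (sym (List.++-assoc L [ 1 ] R)) ρ-increasing)

    1<h∷R′ : All (1 <_) (h ∷ R′)
    1<h∷R′ = rotate-All m r (1<m ∷ subst (All (1 <_)) (sym R≡) 1<R)

    1-rmin : ∀ xs → All (1 <_) xs → belowAll 1 xs ≡ true
    1-rmin = All⇒belowAll≡true 1

    rminFlags-R′ : rminFlags R′ ≡ map isUnboxed r
    rminFlags-R′ = rminFlags-rotate m r-wellBoxed r<m

    profile-R′ : profile R′ ≡ profile R
    profile-R′ = begin
      marked R′ (rminFlags R′)                       ≡⟨ cong (marked R′) rminFlags-R′ ⟩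
      marked R′ (map isUnboxed r)                    ≡⟨ sym (marked-rotate m r) ⟩
      marked (map proj₁ r) (map isUnboxed r)         ≡⟨ cong (marked (map proj₁ r)) (sym (rminFlags-wellBoxed r-wellBoxed)) ⟩
      profile (map proj₁ r)                          ≡⟨ cong profile R≡ ⟩
      profile R                                      ∎
      where open ≡-Reasoning

    nothings : List ℕ → List (Maybe ℕ)
    nothings = map (λ _ → nothing)

    nothings-∷ʳ : ∀ L X → nothings (L ++ [ h ]) ++ X ≡ nothing ∷ nothings L ++ X
    nothings-∷ʳ []      X = refl
    nothings-∷ʳ (x ∷ L) X = cong (nothing ∷_) (nothings-∷ʳ L X)

    L∷h≡ : L ++ h ∷ 1 ∷ R′ ≡ (L ++ [ h ]) ++ 1 ∷ R′
    L∷h≡ = sym (List.++-assoc L [ h ] (1 ∷ R′))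

    1≤L∷h : All (1 ≤_) (L ++ [ h ])
    1≤L∷h = All.++⁺ 1≤L (ℕ.<⇒≤ (All.head 1<h∷R′) ∷ [])

    nonRmins-β : nonRmins (L ++ h ∷ 1 ∷ R′) ≡ L ++ boxedVals r ++ [ m ]
    nonRmins-β = begin
      nonRmins (L ++ h ∷ 1 ∷ R′)                         ≡⟨ cong nonRmins L∷h≡ ⟩
      nonRmins ((L ++ [ h ]) ++ 1 ∷ R′)                  ≡⟨ nonRmins-before-1 (L ++ [ h ]) (1 ∷ R′) (here refl) 1≤L∷h ⟩
      (L ++ [ h ]) ++ nonRmins (1 ∷ R′)                  ≡⟨ cong ((L ++ [ h ]) ++_) (nonRmins-∷-rmin 1 R′ (1-rmin R′ (All.tail 1<h∷R′))) ⟩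
      (L ++ [ h ]) ++ unmarked R′ (rminFlags R′)         ≡⟨ List.++-assoc L [ h ] _ ⟩
      L ++ h ∷ unmarked R′ (rminFlags R′)                ≡⟨ cong (λ z → L ++ h ∷ unmarked R′ z) rminFlags-R′ ⟩
      L ++ h ∷ unmarked R′ (map isUnboxed r)             ≡⟨ cong (L ++_) (unmarked-rotate m r) ⟩
      L ++ boxedVals r ++ [ m ]                          ∎
      where open ≡-Reasoning

  β-shape : β ρ ≡ L ++ h ∷ 1 ∷ R′
  β-shape = β-split L R L-notOne R-notOne

  -- The rotation keeps every right-to-left minimum of ρ in place and the new
  -- letter h in front of 1 is not one, so the profile only gains a leading nothing.
  rprofile-β : rprofile (L ++ h ∷ 1 ∷ R′) ≡ rprofile ρ ++ [ nothing ]
  rprofile-β = trans (cong reverse profile-β) (List.unfold-reverse nothing (profile ρ))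
    where
    profile-β : profile (L ++ h ∷ 1 ∷ R′) ≡ nothing ∷ profile ρ
    profile-β = begin
      profile (L ++ h ∷ 1 ∷ R′)                          ≡⟨ cong profile L∷h≡ ⟩
      profile ((L ++ [ h ]) ++ 1 ∷ R′)                   ≡⟨ profile-before-1 (L ++ [ h ]) (1 ∷ R′) (here refl) 1≤L∷h ⟩
      nothings (L ++ [ h ]) ++ profile (1 ∷ R′)          ≡⟨ cong (nothings (L ++ [ h ]) ++_) (profile-∷-rmin 1 R′ (1-rmin R′ (All.tail 1<h∷R′))) ⟩
      nothings (L ++ [ h ]) ++ just 1 ∷ profile R′       ≡⟨ nothings-∷ʳ L _ ⟩
      nothing ∷ nothings L ++ just 1 ∷ profile R′        ≡⟨ cong (λ z → nothing ∷ nothings L ++ just 1 ∷ z) profile-R′ ⟩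
      nothing ∷ nothings L ++ just 1 ∷ profile R         ≡⟨ cong (λ z → nothing ∷ nothings L ++ z) (sym (profile-∷-rmin 1 R (1-rmin R 1<R))) ⟩
      nothing ∷ nothings L ++ profile (1 ∷ R)            ≡⟨ cong (nothing ∷_) (sym (profile-before-1 L (1 ∷ R) (here refl) 1≤L)) ⟩
      nothing ∷ profile ρ                                ∎
      where open ≡-Reasoning

  nonRmins-β-increasing : Increasing (nonRmins (L ++ h ∷ 1 ∷ R′))
  nonRmins-β-increasing rewrite nonRmins-β =
    AllPairs.++⁺ L-increasing
      (AllPairs.++⁺ (wellBoxed-increasing r-wellBoxed) ([] ∷ []) (All.map (_∷ []) boxed<m))
      (All.tabulate λ z∈L → All.++⁺ (wellBoxed-above r-wellBoxed (there (∈-++⁺ˡ (Any.reverse⁺ z∈L))))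
                                    (≤n⇒<m (proj₂ (All.lookup L-bounds z∈L)) ∷ []))
    where
    L-increasing : Increasing L
    L-increasing = increasing-++⁻ˡ L (subst Increasing nonRmins-ρ ρ-increasing)
      where
      nonRmins-ρ : nonRmins ρ ≡ L ++ nonRmins R
      nonRmins-ρ = trans (nonRmins-before-1 L (1 ∷ R) (here refl) 1≤L) (cong (L ++_) (nonRmins-∷-rmin 1 R (1-rmin R 1<R)))
    boxed<m : All (_< m) (boxedVals r)
    boxed<m = All.tabulate (λ x∈ → All.lookup r<m (∈-boxedVals⁻ r x∈))

  isPerm-β : IsPerm (suc n) (L ++ h ∷ 1 ∷ R′)
  isPerm-β = begin
    L ++ h ∷ 1 ∷ R′             ↭⟨ ↭.++⁺ˡ L (swap h 1 ↭-refl) ⟩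
    L ++ 1 ∷ h ∷ R′             ↭⟨ ↭.++⁺ˡ L (prep 1 (rotate-↭ m r)) ⟩
    L ++ 1 ∷ m ∷ map proj₁ r    ≡⟨ cong (λ z → L ++ 1 ∷ m ∷ z) R≡ ⟩
    L ++ 1 ∷ m ∷ R              ↭⟨ ↭.++⁺ˡ L (swap 1 m ↭-refl) ⟩
    L ++ m ∷ 1 ∷ R              ↭⟨ ↭.shift m L (1 ∷ R) ⟩
    m ∷ ρ                       ↭⟨ subst (λ k → k ∷ ρ ↭ oneToN (suc n)) (sym m≡1+n) (isPerm-∷ ρ-perm) ⟩
    oneToN (suc n)              ∎
    where open PermutationReasoning

corresponds-β-[] : Corresponds 1 [ 1 ] (β [])
corresponds-β-[] = record
  { isPerm = ↭-refl ; nonRmins-increasing = [] ; transposed = transposed-[1] ; transposed⁻¹ = transposed-[1] }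

corresponds-β : ∀ {n τ ρ} → 1 ≤ n → IsPerm n τ → Corresponds n τ ρ → Corresponds (suc n) (suc n ∷ τ) (β ρ)
corresponds-β {n} {τ} 1≤n τ-perm c with ∈-∃++ (isPerm-∈ (Corresponds.isPerm c) (s≤s z≤n) 1≤n)
... | L , R , refl = subst (Corresponds (suc n) (suc n ∷ τ)) (sym β-shape) (record
  { isPerm              = isPerm-β
  ; nonRmins-increasing = nonRmins-β-increasing
  ; transposed          = subst₂ Transposed (sym rprofile-τ) (sym rprofile-β)
                            (transposed-∷ʳ-nothing {rprofile τ} {rprofile ρ} (C.transposed c))
  ; transposed⁻¹        = subst₂ Transposed (sym rprofile-β) (sym rprofile-τ)
                            (transposed-∷ʳ-nothing {rprofile ρ} {rprofile τ} (C.transposed⁻¹ c))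
  })
  where
  module C = Corresponds
  open β-step L R (C.isPerm c) (C.nonRmins-increasing c)
  rprofile-τ : rprofile (suc n ∷ τ) ≡ rprofile τ ++ [ nothing ]
  rprofile-τ = rprofile-∷-nonrmin (suc n) τ (∃≤⇒belowAll≡false (suc n) τ (isPerm-∈ τ-perm (s≤s z≤n) 1≤n) (s≤s z≤n))

-- 321-avoiding permutations are determined by their profile

∈-nonRmins⇒split : ∀ xs {y} → y ∈ nonRmins xs → ∃[ P ] ∃[ Y ] xs ≡ P ++ y ∷ Y × belowAll y Y ≡ false
∈-nonRmins⇒split (x ∷ xs) {y} y∈ = go (belowAll x xs) refl
  where
  go : ∀ b → belowAll x xs ≡ b → ∃[ P ] ∃[ Y ] x ∷ xs ≡ P ++ y ∷ Y × belowAll y Y ≡ false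
  go true e with ∈-nonRmins⇒split xs (subst (y ∈_) (nonRmins-∷-rmin x xs e) y∈)
  ... | P , Y , refl , y-nonrmin = x ∷ P , Y , refl , y-nonrmin
  go false e with subst (y ∈_) (nonRmins-∷-nonrmin x xs e) y∈
  ... | here refl = [] , xs , refl , e
  ... | there y∈′ with ∈-nonRmins⇒split xs y∈′
  ...   | P , Y , refl , y-nonrmin = x ∷ P , Y , refl , y-nonrmin

avoids321-∷ : ∀ x xs → Avoids321 (x ∷ xs) → Avoids321 xs
avoids321-∷ x xs av (suc i) (suc j) (suc k) _ i<j j<k k≤ =
  av (suc (suc i)) (suc (suc j)) (suc (suc k)) (s≤s z≤n) (s≤s i<j) (s≤s j<k) (s≤s k≤)

-- A non-minimum y has a smaller letter z to its right, so an earlier letter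
-- x > y would complete a 321.
avoids321⇒nonRmins-increasing : ∀ w → Avoids321 w → Unique w → Increasing (nonRmins w)
avoids321⇒nonRmins-increasing []       _  _          = []
avoids321⇒nonRmins-increasing (x ∷ xs) av (x∉ ∷ uniq) = go (belowAll x xs) refl
  where
  ih = avoids321⇒nonRmins-increasing xs (avoids321-∷ x xs av) uniq
  x<nonRmins : ∀ {y} → y ∈ nonRmins xs → x < y
  x<nonRmins {y} y∈ with ∈-nonRmins⇒split xs y∈
  ... | P , Y , refl , y-nonrmin with belowAll≡false⇒∃≤ _ Y y-nonrmin
  ...   | z , z∈Y , z≤y with ∈⇒at Y z∈Y
  ...     | k , 1≤k , k≤ , at-z = ℕ.≰⇒> y≰x
    where
    y≢x : ¬ y ≡ x
    y≢x e = All.lookup x∉ (∈-++⁺ʳ P (here refl)) (sym e)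
    z≢y : ¬ z ≡ y
    z≢y e = All.lookup (proj₂ (unique-middle P {y} {Y} uniq)) z∈Y (sym e)
    at-y : at (x ∷ P ++ y ∷ Y) (suc (length P + 1)) ≡ y
    at-y = trans (at-∷ x _ (length P + 1) (ℕ.m≤n+m 1 (length P))) (at-++ P (y ∷ Y) 1 (s≤s z≤n))
    at-z′ : at (x ∷ P ++ y ∷ Y) (suc (length P + suc k)) ≡ z
    at-z′ = trans (at-∷ x _ (length P + suc k) (ℕ.≤-trans (s≤s z≤n) (ℕ.m≤n+m (suc k) (length P))))
              (trans (at-++ P (y ∷ Y) (suc k) (s≤s z≤n)) (trans (at-∷ y Y k 1≤k) at-z))
    y≰x : ¬ y ≤ x
    y≰x y≤x = av 1 (suc (length P + 1)) (suc (length P + suc k)) (s≤s z≤n)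
      (s≤s (ℕ.m≤n+m 1 (length P)))
      (s≤s (ℕ.+-monoʳ-< (length P) (s≤s 1≤k)))
      (subst (suc (length P + suc k) ≤_) (sym (cong suc (List.length-++ P))) (s≤s (ℕ.+-monoʳ-≤ (length P) (s≤s k≤))))
      (subst (_< x) (sym at-y) (ℕ.≤∧≢⇒< y≤x y≢x) ,
       subst₂ _<_ (sym at-z′) (sym at-y) (ℕ.≤∧≢⇒< z≤y z≢y))
  go : ∀ b → belowAll x xs ≡ b → Increasing (nonRmins (x ∷ xs))
  go true  e = subst Increasing (sym (nonRmins-∷-rmin x xs e)) ih
  go false e = subst Increasing (sym (nonRmins-∷-nonrmin x xs e)) (All.tabulate x<nonRmins ∷ ih)

fill : List (Maybe ℕ) → List ℕ → List ℕ
fill []            _        = []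
fill (just x ∷ P)  ys       = x ∷ fill P ys
fill (nothing ∷ P) []       = []
fill (nothing ∷ P) (y ∷ ys) = y ∷ fill P ys

fill-marked-unmarked : ∀ w bs → length bs ≡ length w → fill (marked w bs) (unmarked w bs) ≡ w
fill-marked-unmarked []      []           _ = refl
fill-marked-unmarked (x ∷ w) (true  ∷ bs) e = cong (x ∷_) (fill-marked-unmarked w bs (ℕ.suc-injective e))
fill-marked-unmarked (x ∷ w) (false ∷ bs) e = cong (x ∷_) (fill-marked-unmarked w bs (ℕ.suc-injective e))

fill-profile-nonRmins : ∀ w → fill (profile w) (nonRmins w) ≡ w
fill-profile-nonRmins w = fill-marked-unmarked w (rminFlags w) (length-rminFlags w)

↭-marked-unmarked : ∀ w bs → length bs ≡ length w → w ↭ catMaybes (marked w bs) ++ unmarked w bs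
↭-marked-unmarked []      []           _ = ↭-refl
↭-marked-unmarked (x ∷ w) (true  ∷ bs) e = prep x (↭-marked-unmarked w bs (ℕ.suc-injective e))
↭-marked-unmarked (x ∷ w) (false ∷ bs) e =
  ↭-trans (prep x (↭-marked-unmarked w bs (ℕ.suc-injective e))) (↭-sym (↭.shift x (catMaybes (marked w bs)) _))

↭-profile-nonRmins : ∀ w → w ↭ catMaybes (profile w) ++ nonRmins w
↭-profile-nonRmins w = ↭-marked-unmarked w (rminFlags w) (length-rminFlags w)

↭-++-cancelˡ : ∀ xs {ys zs : List ℕ} → xs ++ ys ↭ xs ++ zs → ys ↭ zs
↭-++-cancelˡ []       p = p
↭-++-cancelˡ (x ∷ xs) p = ↭-++-cancelˡ xs (↭.drop-∷ p)

increasing-↭⇒≡ : ∀ {xs ys} → Increasing xs → Increasing ys → xs ↭ ys → xs ≡ ys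
increasing-↭⇒≡ {[]}     {[]}     _ _ _ = refl
increasing-↭⇒≡ {[]}     {y ∷ ys} _ _ p = ⊥-elim (↭.¬x∷xs↭[] (↭-sym p))
increasing-↭⇒≡ {x ∷ xs} {[]}     _ _ p = ⊥-elim (↭.¬x∷xs↭[] p)
increasing-↭⇒≡ {x ∷ xs} {y ∷ ys} (x<xs ∷ xs↑) (y<ys ∷ ys↑) p =
  cong₂ _∷_ x≡y (increasing-↭⇒≡ xs↑ ys↑ (↭.drop-∷ (subst (λ z → z ∷ xs ↭ y ∷ ys) x≡y p)))
  where
  x≡y : x ≡ y
  x≡y with ↭.∈-resp-↭ p (here refl) | ↭.∈-resp-↭ (↭-sym p) (here refl)
  ... | here e   | _        = e
  ... | there _  | here e   = sym e
  ... | there x∈ | there y∈ = ⊥-elim (ℕ.<-asym (All.lookup y<ys x∈) (All.lookup x<xs y∈))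

-- The letters outside the profile are the same multiset on both sides; being
-- increasing, they are listed in the same order.
profile-injective : ∀ {n σ σ′} → IsPerm n σ → IsPerm n σ′ →
  Increasing (nonRmins σ) → Increasing (nonRmins σ′) → profile σ ≡ profile σ′ → σ ≡ σ′
profile-injective {σ = σ} {σ′} σ-perm σ′-perm σ↑ σ′↑ same = begin
  σ                                    ≡⟨ sym (fill-profile-nonRmins σ) ⟩
  fill (profile σ) (nonRmins σ)        ≡⟨ cong₂ fill same (increasing-↭⇒≡ σ↑ σ′↑ (↭-++-cancelˡ (catMaybes (profile σ′)) rest↭)) ⟩
  fill (profile σ′) (nonRmins σ′)      ≡⟨ fill-profile-nonRmins σ′ ⟩
  σ′                                   ∎
  where
  open ≡-Reasoning
  rest↭ : catMaybes (profile σ′) ++ nonRmins σ ↭ catMaybes (profile σ′) ++ nonRmins σ′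
  rest↭ = subst (λ P → catMaybes P ++ nonRmins σ ↭ catMaybes (profile σ′) ++ nonRmins σ′) same
    (↭-trans (↭-sym (↭-profile-nonRmins σ))
      (↭-trans σ-perm (↭-trans (↭-sym σ′-perm) (↭-profile-nonRmins σ′))))

-- The RMIN of σ at position j+1 is read off from the RMIN of π through
-- the duality with a = n - j.
duality-transfers : ∀ {n π σ₁ σ₂} → IsPerm n σ₁ → RminDuality n π σ₁ → RminDuality n π σ₂ →
  ∀ j {b} → entry (profile σ₁) j ≡ just b → entry (profile σ₂) j ≡ just b
duality-transfers {n} {π} {σ₁} {σ₂} σ₁-perm d₁ d₂ j {b} e
  with entry-profile⇒RMIN σ₁ j b e
... | r₁@(_ , j<n , at-b , _) = RMIN⇒entry-profile σ₂ j b (subst (λ p → RMIN σ₂ p b) position r₂)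
  where
  b-bounds = All.lookup (isPerm-bounds σ₁-perm) (subst (_∈ σ₁) at-b (at-∈ σ₁ (suc j) (s≤s z≤n) j<n))
  j<n′ : j < n
  j<n′ = subst (j <_) (isPerm-length σ₁-perm) j<n
  position : n + 1 ∸ (n ∸ j) ≡ suc j
  position = trans (cong (_∸ (n ∸ j)) (ℕ.+-comm n 1))
               (trans (ℕ.+-∸-assoc 1 (ℕ.m∸n≤m n j)) (cong suc (ℕ.m∸[m∸n]≡n (ℕ.<⇒≤ j<n′))))
  r₂ : RMIN σ₂ (n + 1 ∸ (n ∸ j)) b
  r₂ = Equivalence.to (d₂ b (n ∸ j) (proj₁ b-bounds) (proj₂ b-bounds) (ℕ.m<n⇒0<n∸m j<n′) (ℕ.m∸n≤m n j))
         (Equivalence.from (d₁ b (n ∸ j) (proj₁ b-bounds) (proj₂ b-bounds) (ℕ.m<n⇒0<n∸m j<n′) (ℕ.m∸n≤m n j))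
           (subst (λ p → RMIN σ₁ p b) (sym position) r₁))

duality⇒same-profile : ∀ {n π σ₁ σ₂} → IsPerm n σ₁ → IsPerm n σ₂ →
  RminDuality n π σ₁ → RminDuality n π σ₂ → profile σ₁ ≡ profile σ₂
duality⇒same-profile {π = π} {σ₁} {σ₂} σ₁-perm σ₂-perm d₁ d₂ = entry-ext _ _ same-length same-entry
  where
  same-length : length (profile σ₁) ≡ length (profile σ₂)
  same-length = trans (length-profile σ₁) (trans (isPerm-length σ₁-perm)
                  (sym (trans (length-profile σ₂) (isPerm-length σ₂-perm))))
  same-entry : ∀ j → entry (profile σ₁) j ≡ entry (profile σ₂) j
  same-entry j with entry (profile σ₁) j in e₁ | entry (profile σ₂) j in e₂
  ... | just b  | _       = trans (sym (duality-transfers {π = π} {σ₂ = σ₂} σ₁-perm d₁ d₂ j e₁)) e₂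
  ... | nothing | nothing = refl
  ... | nothing | just b  = trans (sym e₁) (duality-transfers {π = π} {σ₂ = σ₁} σ₂-perm d₂ d₁ j e₂)

-- 231-avoiding permutations split as α(τ) ⊕ rest

-- x followed by ys contains no 231 in which x plays the role of the 2.
No231From : ℕ → List ℕ → Set
No231From x []       = ⊤
No231From x (y ∷ ys) = (x < y → All (x ≤_) ys) × No231From x ys

Free231 : List ℕ → Set
Free231 []       = ⊤
Free231 (x ∷ xs) = No231From x xs × Free231 xs

avoids231⇒free231 : ∀ w → Avoids231 w → Free231 w
avoids231⇒free231 []       _  = tt
avoids231⇒free231 (x ∷ xs) av =
  no231From x xs (λ { (suc j) (suc k) _ j<k k≤ → av 1 (suc (suc j)) (suc (suc k)) (s≤s z≤n) (s≤s (s≤s z≤n)) (s≤s j<k) (s≤s k≤) }) ,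
  avoids231⇒free231 xs (λ { (suc i) (suc j) (suc k) _ i<j j<k k≤ →
    av (suc (suc i)) (suc (suc j)) (suc (suc k)) (s≤s z≤n) (s≤s i<j) (s≤s j<k) (s≤s k≤) })
  where
  no231From : ∀ x ys → (∀ j k → 1 ≤ j → j < k → k ≤ length ys → ¬ (at ys k < x × x < at ys j)) → No231From x ys
  no231From x []       _  = tt
  no231From x (y ∷ ys) av′ = x<y⇒x≤ys , no231From x ys
    (λ { (suc j) (suc k) _ (s≤s j<k) k≤ → av′ (suc (suc j)) (suc (suc k)) (s≤s z≤n) (s≤s (s≤s j<k)) (s≤s k≤) })
    where
    x<y⇒x≤ys : x < y → All (x ≤_) ys
    x<y⇒x≤ys x<y = at⇒All ys (λ { (suc k) _ k≤ →
      ℕ.≮⇒≥ (λ z<x → av′ 1 (suc (suc k)) (s≤s z≤n) (s≤s (s≤s z≤n)) (s≤s k≤) (z<x , x<y)) })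

no231From-++⁻ˡ : ∀ x A B → No231From x (A ++ B) → No231From x A
no231From-++⁻ˡ x []      B _       = tt
no231From-++⁻ˡ x (a ∷ A) B (p , q) = (λ x<a → All.++⁻ˡ A (p x<a)) , no231From-++⁻ˡ x A B q

no231From-++⁻ʳ : ∀ x A B → No231From x (A ++ B) → No231From x B
no231From-++⁻ʳ x []      B p       = p
no231From-++⁻ʳ x (a ∷ A) B (_ , q) = no231From-++⁻ʳ x A B q

free231-++⁻ˡ : ∀ A B → Free231 (A ++ B) → Free231 A
free231-++⁻ˡ []      B _       = tt
free231-++⁻ˡ (a ∷ A) B (p , q) = no231From-++⁻ˡ a A B p , free231-++⁻ˡ A B q

free231-++⁻ʳ : ∀ A B → Free231 (A ++ B) → Free231 B
free231-++⁻ʳ []      B p       = p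
free231-++⁻ʳ (a ∷ A) B (_ , q) = free231-++⁻ʳ A B q

no231From-map-∸ : ∀ c x ys → No231From x ys → No231From (x ∸ c) (map (_∸ c) ys)
no231From-map-∸ c x []       _       = tt
no231From-map-∸ c x (y ∷ ys) (p , q) =
  (λ x∸c<y∸c → All.map⁺ (All.map (ℕ.∸-monoˡ-≤ c) (p (ℕ.≰⇒> (λ y≤x → ℕ.<⇒≱ x∸c<y∸c (ℕ.∸-monoˡ-≤ c y≤x)))))) ,
  no231From-map-∸ c x ys q

free231-map-∸ : ∀ c w → Free231 w → Free231 (map (_∸ c) w)
free231-map-∸ c []      _       = tt
free231-map-∸ c (x ∷ w) (p , q) = no231From-map-∸ c x w p , free231-map-∸ c w q

private
  HeadAtLeast : ℕ → List ℕ → Set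
  HeadAtLeast x []      = ⊤
  HeadAtLeast x (b ∷ _) = x ≤ b

  splitBelow : ∀ x ys → ∃[ A ] ∃[ B ] ys ≡ A ++ B × All (_< x) A × HeadAtLeast x B
  splitBelow x []       = [] , [] , refl , [] , tt
  splitBelow x (y ∷ ys) with y <? x
  ... | no y≮x = [] , y ∷ ys , refl , [] , ℕ.≮⇒≥ y≮x
  ... | yes y<x with splitBelow x ys
  ...   | A , B , refl , A<x , B≥x = y ∷ A , B , refl , y<x ∷ A<x , B≥x

split-free231 : ∀ {n x π′} → IsPerm n (x ∷ π′) → Free231 (x ∷ π′) →
  ∃[ A ] ∃[ B ] π′ ≡ A ++ B × All (_< x) A × All (x <_) B
split-free231 {x = x} {π′} perm (no231 , _) with splitBelow x π′
... | A , B , refl , A<x , B≥x = A , B , refl , A<x ,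
  above B B≥x (no231From-++⁻ʳ x A B no231) (All.++⁻ʳ A (AllPairs.head (isPerm-unique perm)))
  where
  above : ∀ B → HeadAtLeast x B → No231From x B → All (λ y → ¬ x ≡ y) B → All (x <_) B
  above []      _   _       _          = []
  above (b ∷ B) x≤b (p , _) (x≢b ∷ x∉B) = x<b ∷ All.zipWith (λ { (x≤y , x≢y) → ℕ.≤∧≢⇒< x≤y x≢y }) (p x<b , x∉B)
    where x<b = ℕ.≤∧≢⇒< x≤b x≢b

filter-<-oneToN : ∀ {x n} → 1 ≤ x → x ∸ 1 ≤ n → filter (_<? x) (oneToN n) ≡ oneToN (x ∸ 1)
filter-<-oneToN {suc x} {n} _ x≤n = begin
  filter (_<? suc x) (oneToN n)                                       ≡⟨ cong (filter (_<? suc x) ∘ oneToN) (sym (ℕ.m+[n∸m]≡n x≤n)) ⟩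
  filter (_<? suc x) (oneToN (x + (n ∸ x)))                           ≡⟨ cong (filter (_<? suc x)) (oneToN-+ x (n ∸ x)) ⟩
  filter (_<? suc x) (oneToN x ++ map (_+ x) (oneToN (n ∸ x)))        ≡⟨ List.filter-++ (_<? suc x) (oneToN x) _ ⟩
  filter (_<? suc x) (oneToN x) ++ filter (_<? suc x) (map (_+ x) (oneToN (n ∸ x)))
    ≡⟨ cong₂ _++_ (List.filter-all (_<? suc x) (All.tabulate (s≤s ∘ proj₂ ∘ ∈-oneToN⁻)))
                  (List.filter-none (_<? suc x) (All.map⁺ {xs = oneToN (n ∸ x)} (All.tabulate λ y∈ y+x<1+x →
                     ℕ.<⇒≱ y+x<1+x (ℕ.+-monoˡ-≤ x (proj₁ (∈-oneToN⁻ y∈)))))) ⟩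
  oneToN x ++ []                                                      ≡⟨ List.++-identityʳ _ ⟩
  oneToN x                                                            ∎
  where open ≡-Reasoning

filter->-oneToN : ∀ {x n} → x ≤ n → filter (x <?_) (oneToN n) ≡ map (_+ x) (oneToN (n ∸ x))
filter->-oneToN {x} {n} x≤n = begin
  filter (x <?_) (oneToN n)                                           ≡⟨ cong (filter (x <?_) ∘ oneToN) (sym (ℕ.m+[n∸m]≡n x≤n)) ⟩
  filter (x <?_) (oneToN (x + (n ∸ x)))                               ≡⟨ cong (filter (x <?_)) (oneToN-+ x (n ∸ x)) ⟩
  filter (x <?_) (oneToN x ++ map (_+ x) (oneToN (n ∸ x)))            ≡⟨ List.filter-++ (x <?_) (oneToN x) _ ⟩
  filter (x <?_) (oneToN x) ++ filter (x <?_) (map (_+ x) (oneToN (n ∸ x)))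
    ≡⟨ cong₂ _++_ (List.filter-none (x <?_) (All.tabulate λ y∈ x<y → ℕ.<⇒≱ x<y (proj₂ (∈-oneToN⁻ y∈))))
                  (List.filter-all (x <?_) (All.map⁺ {xs = oneToN (n ∸ x)} (All.tabulate λ y∈ → ℕ.+-monoˡ-≤ x (proj₁ (∈-oneToN⁻ y∈))))) ⟩
  map (_+ x) (oneToN (n ∸ x))                                         ∎
  where open ≡-Reasoning

module _ {n x : ℕ} {A B : List ℕ} (perm : IsPerm n (x ∷ A ++ B)) (A<x : All (_< x) A) (x<B : All (x <_) B) where

  private
    x-bounds = All.head (isPerm-bounds perm)

  isPerm-below-first : IsPerm (x ∸ 1) A
  isPerm-below-first = subst₂ _↭_ letters
    (filter-<-oneToN (proj₁ x-bounds) (ℕ.≤-trans (ℕ.m∸n≤m x 1) (proj₂ x-bounds))) (↭.filter-↭ (_<? x) perm)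
    where
    letters : filter (_<? x) (x ∷ A ++ B) ≡ A
    letters = begin
      filter (_<? x) (x ∷ A ++ B)                 ≡⟨ List.filter-reject (_<? x) (ℕ.<-irrefl refl) ⟩
      filter (_<? x) (A ++ B)                     ≡⟨ List.filter-++ (_<? x) A B ⟩
      filter (_<? x) A ++ filter (_<? x) B        ≡⟨ cong₂ _++_ (List.filter-all (_<? x) A<x) (List.filter-none (_<? x) (All.map ℕ.<⇒≯ x<B)) ⟩
      A ++ []                                     ≡⟨ List.++-identityʳ A ⟩
      A                                           ∎
      where open ≡-Reasoning

  isPerm-above-first : IsPerm (n ∸ x) (map (_∸ x) B)
  isPerm-above-first = subst (map (_∸ x) B ↭_) shift-back
    (↭.map⁺ (_∸ x) (subst₂ _↭_ letters (filter->-oneToN (proj₂ x-bounds)) (↭.filter-↭ (x <?_) perm)))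
    where
    letters : filter (x <?_) (x ∷ A ++ B) ≡ B
    letters = begin
      filter (x <?_) (x ∷ A ++ B)                 ≡⟨ List.filter-reject (x <?_) (ℕ.<-irrefl refl) ⟩
      filter (x <?_) (A ++ B)                     ≡⟨ List.filter-++ (x <?_) A B ⟩
      filter (x <?_) A ++ filter (x <?_) B        ≡⟨ cong₂ _++_ (List.filter-none (x <?_) (All.map ℕ.<⇒≯ A<x)) (List.filter-all (x <?_) x<B) ⟩
      B                                           ∎
      where open ≡-Reasoning
    shift-back : map (_∸ x) (map (_+ x) (oneToN (n ∸ x))) ≡ oneToN (n ∸ x)
    shift-back = trans (sym (List.map-∘ (oneToN (n ∸ x)))) (List.map-id-local (All.tabulate (λ {y} _ → ℕ.m+n∸n≡m y x)))

-- The running maximum stays at the first letter x, so splitGo stops exactly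
-- when it has read x letters.
splitGo-below : ∀ x a A c acc B → All (_< x) (a ∷ A) → c + length (a ∷ A) ≡ x →
  splitGo x c acc ((a ∷ A) ++ B) ≡ (reverse acc ++ a ∷ A , B)
splitGo-below x a [] c acc B (a<x ∷ []) e
  rewrite ℕ.m≥n⇒m⊔n≡m (ℕ.<⇒≤ a<x) | ≡⇒≡ᵇ≡true (trans (sym e) (ℕ.+-comm c 1)) =
  cong (_, B) (List.unfold-reverse a acc)
splitGo-below x a (a′ ∷ A) c acc B (a<x ∷ A<x) e
  rewrite ℕ.m≥n⇒m⊔n≡m (ℕ.<⇒≤ a<x)
        | ≢⇒≡ᵇ≡false {x} {suc c}
            (λ x≡1+c → ℕ.m+1+n≢m (suc c) (sym (trans (sym x≡1+c) (trans (sym e) (ℕ.+-suc c _))))) = begin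
  splitGo x (suc c) (a ∷ acc) ((a′ ∷ A) ++ B)    ≡⟨ splitGo-below x a′ A (suc c) (a ∷ acc) B A<x (trans (sym (ℕ.+-suc c _)) e) ⟩
  (reverse (a ∷ acc) ++ a′ ∷ A , B)              ≡⟨ cong (λ z → (z ++ a′ ∷ A , B)) (List.unfold-reverse a acc) ⟩
  ((reverse acc ++ [ a ]) ++ a′ ∷ A , B)         ≡⟨ cong (_, B) (List.++-assoc (reverse acc) [ a ] (a′ ∷ A)) ⟩
  (reverse acc ++ a ∷ a′ ∷ A , B)                ∎
  where open ≡-Reasoning

splitFirst-α : ∀ x A B → All (_< x) A → suc (length A) ≡ x → splitFirst (x ∷ A ++ B) ≡ (x ∷ A , B)
splitFirst-α x []      B _   refl = refl
splitFirst-α x (a ∷ A) B A<x refl = splitGo-below _ a A 1 (_ ∷ []) B A<x refl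

components-α : ∀ g x A B → All (_< x) A → suc (length A) ≡ x →
  components (suc g) (x ∷ A ++ B) ≡ (x ∷ A) ∷ components g (map (_∸ x) B)
components-α g x A B A<x e rewrite splitFirst-α x A B A<x e | e = refl

⊕-α : ∀ x A B → All (x <_) B → suc (length A) ≡ x → (x ∷ A) ⊕ map (_∸ x) B ≡ x ∷ A ++ B
⊕-α x A B x<B e = cong (x ∷_) (cong (A ++_) (begin
  map (_+ suc (length A)) (map (_∸ x) B)   ≡⟨ cong (λ k → map (_+ k) (map (_∸ x) B)) e ⟩
  map (_+ x) (map (_∸ x) B)                ≡⟨ sym (List.map-∘ B) ⟩
  map (λ y → y ∸ x + x) B                  ≡⟨ List.map-id-local (All.map (ℕ.m∸n+n≡m ∘ ℕ.<⇒≤) x<B) ⟩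
  B                                        ∎))
  where open ≡-Reasoning

phi-[] : ∀ f → phi f [] ≡ []
phi-[] zero    = refl
phi-[] (suc f) = refl

components-[] : ∀ g → components g [] ≡ []
components-[] zero    = refl
components-[] (suc g) = refl

suc-∸1 : ∀ {x} → 1 ≤ x → suc (x ∸ 1) ≡ x
suc-∸1 (s≤s _) = refl

CorrespondsWithFuel : ℕ → Set
CorrespondsWithFuel f = ∀ {n w} → n ≤ f → IsPerm n w → Free231 w → Corresponds n w (phi f w)

module _ (f : ℕ) (ih : CorrespondsWithFuel f) where

  corresponds-phiInd : ∀ {x A} → 1 ≤ x → x ≤ suc f → IsPerm (x ∸ 1) A → Free231 A →
    Corresponds x (x ∷ A) (phiInd f (x ∷ A))
  corresponds-phiInd {suc zero}    {[]}    _ _  _    _ rewrite phi-[] f = corresponds-β-[]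
  corresponds-phiInd {suc zero}    {a ∷ A} _ _  perm _ with isPerm-length perm
  ... | ()
  corresponds-phiInd {suc (suc x)} {A}     _ x≤ perm free = corresponds-β (s≤s z≤n) perm (ih (ℕ.≤-pred x≤) perm free)

  corresponds-components : ∀ g {n w} → n ≤ g → n ≤ suc f → IsPerm n w → Free231 w →
    Corresponds n w (foldl (λ acc c → phiInd f c ⊕ acc) [] (components g w))
  corresponds-components g       {w = []}    _   _ perm _
    rewrite components-[] g | sym (isPerm-length perm) = corresponds-[]
  corresponds-components zero    {w = x ∷ w} n≤0 _ perm _ with trans (isPerm-length perm) (ℕ.n≤0⇒n≡0 n≤0)
  ... | ()
  corresponds-components (suc g) {n} {x ∷ π′} n≤g n≤f perm free with split-free231 perm free
  ... | A , B , refl , A<x , x<B =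
    subst₂ (Corresponds n) (⊕-α x A B x<B |x∷A|) (sym fold-α)
      (subst (λ k → Corresponds k ((x ∷ A) ⊕ map (_∸ x) B) (foldl step [] cs ⊕ phiInd f (x ∷ A)))
        (ℕ.m+[n∸m]≡n x≤n) (corresponds-⊕ α-perm B′-perm α-corr B′-corr))
    where
    step = λ acc c → phiInd f c ⊕ acc
    cs = components g (map (_∸ x) B)
    1≤x = proj₁ (All.head (isPerm-bounds perm))
    x≤n = proj₂ (All.head (isPerm-bounds perm))
    A-perm = isPerm-below-first perm A<x x<B
    B′-perm = isPerm-above-first perm A<x x<B
    α-perm : IsPerm x (x ∷ A)
    α-perm = subst (λ k → IsPerm k (k ∷ A)) (suc-∸1 1≤x) (isPerm-∷ A-perm)
    |x∷A| : suc (length A) ≡ x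
    |x∷A| = trans (cong suc (isPerm-length A-perm)) (suc-∸1 1≤x)
    α-corr : Corresponds x (x ∷ A) (phiInd f (x ∷ A))
    α-corr = corresponds-phiInd 1≤x (ℕ.≤-trans x≤n n≤f) A-perm (free231-++⁻ˡ A B (proj₂ free))
    B′-corr : Corresponds (n ∸ x) (map (_∸ x) B) (foldl step [] cs)
    B′-corr = corresponds-components g (ℕ.≤-trans (ℕ.∸-monoʳ-≤ n 1≤x) (ℕ.∸-monoˡ-≤ 1 n≤g))
      (ℕ.≤-trans (ℕ.m∸n≤m n x) n≤f) B′-perm (free231-map-∸ x B (free231-++⁻ʳ A B (proj₂ free)))
    fold-α : foldl step [] (components (suc g) (x ∷ A ++ B)) ≡ foldl step [] cs ⊕ phiInd f (x ∷ A)
    fold-α = begin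
      foldl step [] (components (suc g) (x ∷ A ++ B))   ≡⟨ cong (foldl step []) (components-α g x A B A<x |x∷A|) ⟩
      foldl step (phiInd f (x ∷ A) ⊕ []) cs             ≡⟨ foldl-⊕ (phiInd f) cs (phiInd f (x ∷ A) ⊕ []) ⟩
      foldl step [] cs ⊕ (phiInd f (x ∷ A) ⊕ [])        ≡⟨ cong (foldl step [] cs ⊕_) (⊕-identityʳ (phiInd f (x ∷ A))) ⟩
      foldl step [] cs ⊕ phiInd f (x ∷ A)               ∎
      where open ≡-Reasoning

corresponds-phi : ∀ f → CorrespondsWithFuel f
corresponds-phi zero    {w = []}    _   perm _ rewrite sym (isPerm-length perm) = corresponds-[]
corresponds-phi zero    {w = x ∷ w} n≤0 perm _ with trans (isPerm-length perm) (ℕ.n≤0⇒n≡0 n≤0)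
... | ()
corresponds-phi (suc f) n≤ = corresponds-components f (corresponds-phi f) (suc f) n≤ n≤

corresponds-Φ : ∀ {n π} → IsPerm n π → Free231 π → Corresponds n π (Φ π)
corresponds-Φ {n} {π} perm free =
  subst (λ f → Corresponds n π (phi f π)) (sym (isPerm-length perm)) (corresponds-phi n ℕ.≤-refl perm free)

lemma3 : (n : ℕ) → 1 ≤ n → (π σ : List ℕ) →
    IsPerm n π → Avoids231 π → IsPerm n σ → Avoids321 σ →
    (Φ π ≡ σ) ⇔ (∀ i a → 1 ≤ i → i ≤ n → 1 ≤ a → a ≤ n →
    (RMIN π (n + 1 ∸ i) a ⇔ RMIN σ (n + 1 ∸ a) i))
lemma3 n _ π σ π-perm π-avoids σ-perm σ-avoids = mk⇔
  (λ { refl → Φπ-duality })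
  (λ σ-duality → profile-injective Φπ-perm σ-perm (Corresponds.nonRmins-increasing Φπ-corr)
    (avoids321⇒nonRmins-increasing σ σ-avoids (isPerm-unique σ-perm))
    (duality⇒same-profile {π = π} Φπ-perm σ-perm Φπ-duality σ-duality))
  where
  Φπ-corr : Corresponds n π (Φ π)
  Φπ-corr = corresponds-Φ π-perm (avoids231⇒free231 π π-avoids)
  Φπ-perm = Corresponds.isPerm Φπ-corr
  Φπ-duality : RminDuality n π (Φ π)
  Φπ-duality = corresponds⇒duality π-perm Φπ-corr
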